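{- Let $X$ be a finite set, let $\mathcal B$ and $\mathcal B^*$ be pre-matroids on $X$, and let $B\mapsto B^*$ be a linking $\mathcal B\to\mathcal B^*$. If $\mathcal B$ is a matroid, then the Whitney multi-set $\mathbb W_\omega(\mathcal B\to\mathcal B^*)$ does not depend on the choice of the linear order $\omega$ on $X$.
   Context: A pre-matroid on a finite set $X$ is a non-empty set $\mathcal B$ of subsets of $X$, whose elements are called bases. For $Y\subseteq X$ and $x\in X\setminus Y$ write $Y+x=Y\cup\{x\}$; for $y\in Y$ write $Y-y=Y\setminus\{y\}$. An almost-basis of $\mathcal B$ is a set $B-x$ with $B\in\mathcal B$, $x\in B$; for an almost-basis $D$ let $U(D)=\{x\in X\setminus D: D+x\in\mathcal B\}$ (non-empty). $\mathcal B$ is a matroid if for all $B_1,B_2\in\mathcal B$ and $x\in B_1\setminus B_2$ there is $y\in B_2\setminus B_1$ with $B_1-x+y\in\mathcal B$. A transposition of $X$ is a permutation exchanging two distinct elements and fixing all others; permutations act on subsets elementwise. A bijection $\mathcal B\to\mathcal B^*$, $B\mapsto B^*$, between pre-matroids on $X$ is a linking if for every $B\in\mathcal B$ and every transposition $\tau$: (L1) if $\tau(B)\in\mathcal B$ then $\tau(B^*)\in\mathcal B^*$ and $\tau(B^*)=\tau(B)^*$; (L2) if $\tau(B^*)\in\mathcal B^*$ then $\tau(B)\in\mathcal B$ and $\tau(B^*)=\tau(B)^*$. For a linear order $\omega$ on $X$ and an almost-basis $D$ of a pre-matroid, let $\varphi_\omega(D)=D+\min_\omega U(D)$, a basis; for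 a basis $B$ let $i_\omega(B)$ be the number of almost-bases $D$ with $\varphi_\omega(D)=B$. These are computed in $\mathcal B$ for bases of $\mathcal B$ and in $\mathcal B^*$ for bases of $\mathcal B^*$. The Whitney multi-set $\mathbb W_\omega(\mathcal B\to\mathcal B^*)$ is the multi-subset of $\mathbb N\times\mathbb N$ (a function $\mathbb N\times\mathbb N\to\mathbb N$) assigning to $(p,q)$ the number of $B\in\mathcal B$ with $(i_\omega(B),i_\omega(B^*))=(p,q)$. -}

module Defs where

open import Data.Nat using (ℕ; zero; suc; _≤ᵇ_; _≡ᵇ_)
open import Data.Bool using (Bool; true; false; _∧_; not; T; if_then_else_)
import Data.Bool.Properties as BoolP
open import Data.Fin using (Fin; toℕ)
open import Data.Fin.Subset using (Subset; _∈_; _∉_; inside; outside)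
open import Data.Fin.Permutation using (Permutation′; _⟨$⟩ʳ_; _⟨$⟩ˡ_; transpose)
open import Data.List using (List; []; _∷_; _++_; map; allFin)
open import Data.Bool.ListAction using (any; all)
open import Data.Vec using (Vec; []; _∷_; lookup; tabulate; _[_]≔_)
import Data.Vec.Properties as VecP
open import Data.Product using (Σ; ∃; _×_; _,_; proj₁)
open import Function.Bundles using (_⤖_; Bijection)
open import Relation.Nullary using (does; ¬_; yes; no)
open import Relation.Nullary.Decidable using (T?)
open import Relation.Binary.PropositionalEquality using (_≡_)

-- The ground set X is Fin n.  A pre-matroid is given by the (decidable)
-- characteristic function of its set of bases, together with non-emptiness.
record PreMatroid (n : ℕ) : Set where
  field
    isBasis  : Subset n → Bool
    nonempty : ∃ λ B → T (isBasis B)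
open PreMatroid public

Bases : ∀ {n} → PreMatroid n → Set
Bases 𝓑 = Σ (Subset _) (λ B → T (isBasis 𝓑 B))

_+ₛ_ : ∀ {n} → Subset n → Fin n → Subset n
Y +ₛ x = Y [ x ]≔ inside

_-ₛ_ : ∀ {n} → Subset n → Fin n → Subset n
Y -ₛ y = Y [ y ]≔ outside

IsMatroid : ∀ {n} → PreMatroid n → Set
IsMatroid {n} 𝓑 =
  (B₁ B₂ : Subset n) → T (isBasis 𝓑 B₁) → T (isBasis 𝓑 B₂) →
  (x : Fin n) → x ∈ B₁ → x ∉ B₂ →
  ∃ λ (y : Fin n) → y ∈ B₂ × y ∉ B₁ × T (isBasis 𝓑 ((B₁ -ₛ x) +ₛ y))

-- Action of a permutation on subsets: σ(S) = { σ x | x ∈ S }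
act : ∀ {n} → Permutation′ n → Subset n → Subset n
act σ S = tabulate (λ k → lookup S (σ ⟨$⟩ˡ k))

-- A linking 𝓑 → 𝓑* : a bijection Bases 𝓑 → Bases 𝓑* with (L1), (L2),
-- quantified over all transpositions (transpose i j with i ≢ j).
record Linking {n : ℕ} (𝓑 𝓑* : PreMatroid n) : Set where
  field
    bij : Bases 𝓑 ⤖ Bases 𝓑*
  star : Bases 𝓑 → Subset n
  star b = proj₁ (Bijection.to bij b)
  field
    L1 : (B : Subset n) (b : T (isBasis 𝓑 B)) (i j : Fin n) → ¬ (i ≡ j) →
         (q : T (isBasis 𝓑 (act (transpose i j) B))) →
         Σ (T (isBasis 𝓑* (act (transpose i j) (star (B , b))))) λ _ →
           act (transpose i j) (star (B , b)) ≡ star (act (transpose i j) B , q)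
    L2 : (B : Subset n) (b : T (isBasis 𝓑 B)) (i j : Fin n) → ¬ (i ≡ j) →
         T (isBasis 𝓑* (act (transpose i j) (star (B , b)))) →
         Σ (T (isBasis 𝓑 (act (transpose i j) B))) λ r →
           act (transpose i j) (star (B , b)) ≡ star (act (transpose i j) B , r)
open Linking public

allSubsets : ∀ n → List (Subset n)
allSubsets zero    = [] ∷ []
allSubsets (suc n) = map (true ∷_) (allSubsets n) ++ map (false ∷_) (allSubsets n)

count : ∀ {A : Set} → (A → Bool) → List A → ℕ
count p []       = 0
count p (x ∷ xs) = if p x then suc (count p xs) else count p xs

_==ₛ_ : ∀ {n} → Subset n → Subset n → Bool
S ==ₛ T′ = does (VecP.≡-dec BoolP._≟_ S T′)

memᵇ : ∀ {n} → Fin n → Subset n → Bool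
memᵇ x S = lookup S x

_⇒ᵇ_ : Bool → Bool → Bool
a ⇒ᵇ b = not a Data.Bool.∨ b

isAlmostBasisᵇ : ∀ {n} → PreMatroid n → Subset n → Bool
isAlmostBasisᵇ {n} 𝓑 D =
  any (λ B → any (λ x → isBasis 𝓑 B ∧ memᵇ x B ∧ (D ==ₛ (B -ₛ x))) (allFin n))
      (allSubsets n)

inUᵇ : ∀ {n} → PreMatroid n → Subset n → Fin n → Bool
inUᵇ 𝓑 D x = not (memᵇ x D) ∧ isBasis 𝓑 (D +ₛ x)

-- A linear order ω on Fin n is encoded by a bijection ω : Fin n → Fin n
-- (x <_ω y iff ω x < ω y); every linear order on Fin n arises this way.
rank : ∀ {n} → Permutation′ n → Fin n → ℕ
rank ω x = toℕ (ω ⟨$⟩ʳ x)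

-- D is an almost-basis and φ_ω(D) = D + min_ω U(D) equals B
φ≡ᵇ : ∀ {n} → PreMatroid n → Permutation′ n → Subset n → Subset n → Bool
φ≡ᵇ {n} 𝓑 ω D B =
  isAlmostBasisᵇ 𝓑 D ∧
  any (λ x → inUᵇ 𝓑 D x
             ∧ all (λ y → inUᵇ 𝓑 D y ⇒ᵇ (rank ω x ≤ᵇ rank ω y)) (allFin n)
             ∧ ((D +ₛ x) ==ₛ B))
      (allFin n)

index : ∀ {n} → PreMatroid n → Permutation′ n → Subset n → ℕ
index {n} 𝓑 ω B = count (λ D → φ≡ᵇ 𝓑 ω D B) (allSubsets n)

-- B ↦ B* extended to all subsets (identity off the bases; only used on bases)
starS : ∀ {n} {𝓑 𝓑* : PreMatroid n} → Linking 𝓑 𝓑* → Subset n → Subset n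
starS {𝓑 = 𝓑} L B with T? (isBasis 𝓑 B)
... | yes b = star L (B , b)
... | no _  = B

Whitney : ∀ {n} {𝓑 𝓑* : PreMatroid n} → Linking 𝓑 𝓑* → Permutation′ n → ℕ × ℕ → ℕ
Whitney {n} {𝓑} {𝓑*} L ω (p , q) =
  count (λ B → isBasis 𝓑 B ∧ (index 𝓑 ω B ≡ᵇ p) ∧ (index 𝓑* ω (starS L B) ≡ᵇ q))
        (allSubsets n)

-- An exchange step B ↦ B - x + y is the transposition (x y) applied to B, so by
-- (L1) a linking satisfies (B - x + y)* = (x y) B*.  At one basis B₀, every
-- transposition fixing B₀ fixes B₀*, so B₀* = g ∘ B₀ pointwise for a Boolean
-- function g; since the bases of a matroid are connected by exchange steps,
-- B* = g ∘ B for every basis.  Thus either B* = B, or B* is the complement of B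
-- and 𝓑* is the dual matroid, or both pre-matroids have a single basis.
--
-- The index i_ω(B) is the number of ω-internally active elements of B, and i_ω(B*)
-- is accordingly the internal or the external activity of B (or a constant).  The
-- joint distribution of internal and external activity does not depend on ω:
-- expanding at the ω-largest element gives the deletion–contraction recursion of
-- the Tutte polynomial, and that recursion returns the same value whichever
-- element it is started at.

module Submission where

open import Defs
open import Algebra.Bundles using (CommutativeMonoid)
open import Data.Bool using (Bool; true; false; _∧_; _∨_; not; T; if_then_else_)
open import Data.Bool.ListAction using (any; all)
open import Data.Bool.Properties
  using (T-irrelevant; T-≡; T-not-≡; T-∧; T-∨; ∧-zeroʳ; not-involutive; ∧-commutativeMonoid; ¬-not)
  renaming (_≟_ to _≟ᵇ_)
open import Data.Empty using (⊥; ⊥-elim)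
open import Data.Fin using (Fin; zero; suc; punchIn; punchOut)
open import Data.Fin.Permutation using (Permutation′; _⟨$⟩ˡ_; inverseˡ; transpose)
import Data.Fin.Permutation.Components as PC
open import Data.Fin.Properties
  using (punchIn-punchOut; punchInᵢ≢i; punchIn-injective; any?; suc-injective; toℕ-injective)
  renaming (_≟_ to _≟ᶠ_)
open import Data.Fin.Subset using (Subset; ∁)
open import Data.List using (List; []; _∷_; _++_; allFin) renaming (map to mapᴸ)
open import Data.List.Membership.Propositional using (lose) renaming (_∈_ to _∈ᴸ_)
open import Data.List.Membership.Propositional.Properties using (∈-allFin; ∈-++⁺ˡ; ∈-++⁺ʳ; ∈-map⁺)
import Data.List.Relation.Unary.All as All
open import Data.List.Relation.Unary.All.Properties using (all⁺; all⁻)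
open import Data.List.Relation.Unary.Any using (here; satisfied)
open import Data.List.Relation.Unary.Any.Properties using (any⁺; any⁻)
open import Data.Nat using (ℕ; zero; suc; _+_; _≤_; _<_; _≡ᵇ_; _≤ᵇ_; z≤n; s≤s)
open import Data.Nat.Induction using (<-wellFounded)
open import Data.Nat.Properties
  using (≤-refl; ≤-trans; ≤-total; <⇒≤; <⇒≱; ≤∧≢⇒<; ≤ᵇ⇒≤; ≤⇒≤ᵇ; +-comm; +-mono-≤; +-suc; ≡ᵇ⇒≡;
         m+n≡0⇒m≡0; m+n≡0⇒n≡0; +-commutativeSemigroup)
open import Algebra.Properties.CommutativeSemigroup +-commutativeSemigroup
  using (interchange; x∙yz≈y∙xz)
open import Algebra.Properties.CommutativeSemigroup
  (CommutativeMonoid.commutativeSemigroup ∧-commutativeMonoid)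
  using () renaming (x∙yz≈y∙xz to ∧-swapˡ)
open import Data.Product using (_×_; ∃; _,_; proj₁; proj₂)
open import Data.Sum using (_⊎_; inj₁; inj₂)
open import Data.Unit using (tt)
open import Data.Vec using (Vec; []; _∷_; lookup; insertAt; removeAt; replicate; _[_]≔_) renaming (map to mapⱽ)
import Data.Vec.Properties as VecP
open import Function using (_∘_; id)
open import Function.Bundles using (Equivalence; Bijection)
open import Function.Definitions using (Injective)
open import Induction.WellFounded using (Acc; acc)
open import Relation.Binary.PropositionalEquality
  using (_≡_; _≢_; refl; sym; trans; cong; cong₂; subst; module ≡-Reasoning)
open import Relation.Nullary using (yes; no)
open import Relation.Nullary.Decidable using (_×-dec_; dec-true; dec-false; T?)

open Equivalence using (to; from)

bit : Bool → ℕ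
bit true  = 1
bit false = 0

true≢false : true ≢ false
true≢false ()

T-ext : ∀ {a b : Bool} → (T a → T b) → (T b → T a) → a ≡ b
T-ext {false} {false} _ _ = refl
T-ext {false} {true}  _ g = ⊥-elim (g tt)
T-ext {true}  {false} f _ = ⊥-elim (f tt)
T-ext {true}  {true}  _ _ = refl

∧-congˡ-T : ∀ a {x y : Bool} → (T a → x ≡ y) → a ∧ x ≡ a ∧ y
∧-congˡ-T true  h = h tt
∧-congˡ-T false h = refl

lookup-ext : ∀ {A : Set} {n} {u v : Vec A n} → (∀ i → lookup u i ≡ lookup v i) → u ≡ v
lookup-ext {u = u} {v} h =
  trans (sym (VecP.tabulate∘lookup u)) (trans (VecP.tabulate-cong h) (VecP.tabulate∘lookup v))

≡-or-punchIn : ∀ {n} (e i : Fin (suc n)) → i ≡ e ⊎ ∃ λ j → i ≡ punchIn e j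
≡-or-punchIn e i with i ≟ᶠ e
... | yes i≡e = inj₁ i≡e
... | no  i≢e = inj₂ (punchOut (i≢e ∘ sym) , sym (punchIn-punchOut (i≢e ∘ sym)))

insertAt-ext : ∀ {A : Set} {n} (e : Fin (suc n)) {u v : Vec A (suc n)} →
  lookup u e ≡ lookup v e → (∀ j → lookup u (punchIn e j) ≡ lookup v (punchIn e j)) → u ≡ v
insertAt-ext e {u} {v} at-e elsewhere = lookup-ext λ i → at (≡-or-punchIn e i)
  where
  at : ∀ {i} → i ≡ e ⊎ (∃ λ j → i ≡ punchIn e j) → lookup u i ≡ lookup v i
  at (inj₁ refl)       = at-e
  at (inj₂ (j , refl)) = elsewhere j

insertAt-update-punchIn : ∀ {A : Set} {n} (S : Vec A n) (e : Fin (suc n)) (b v : A) (j : Fin n) →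
  insertAt S e b [ punchIn e j ]≔ v ≡ insertAt (S [ j ]≔ v) e b
insertAt-update-punchIn S e b v j = insertAt-ext e
  (begin
    lookup (insertAt S e b [ punchIn e j ]≔ v) e ≡⟨ VecP.lookup∘update′ (punchInᵢ≢i e j ∘ sym) (insertAt S e b) v ⟩
    lookup (insertAt S e b) e                    ≡⟨ VecP.insertAt-lookup S e b ⟩
    b                                            ≡⟨ VecP.insertAt-lookup (S [ j ]≔ v) e b ⟨
    lookup (insertAt (S [ j ]≔ v) e b) e         ∎)
  punched
  where
  open ≡-Reasoning
  punched : ∀ k → lookup (insertAt S e b [ punchIn e j ]≔ v) (punchIn e k)
                ≡ lookup (insertAt (S [ j ]≔ v) e b) (punchIn e k)
  punched k with k ≟ᶠ j
  ... | yes refl = trans (VecP.lookup∘update (punchIn e k) (insertAt S e b) v)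
                         (sym (trans (VecP.insertAt-punchIn (S [ k ]≔ v) e b k) (VecP.lookup∘update k S v)))
  ... | no k≢j = begin
    lookup (insertAt S e b [ punchIn e j ]≔ v) (punchIn e k)
      ≡⟨ VecP.lookup∘update′ (k≢j ∘ punchIn-injective e k j) (insertAt S e b) v ⟩
    lookup (insertAt S e b) (punchIn e k)     ≡⟨ VecP.insertAt-punchIn S e b k ⟩
    lookup S k                                ≡⟨ VecP.lookup∘update′ k≢j S v ⟨
    lookup (S [ j ]≔ v) k                     ≡⟨ VecP.insertAt-punchIn (S [ j ]≔ v) e b k ⟨
    lookup (insertAt (S [ j ]≔ v) e b) (punchIn e k) ∎

insertAt-update-self : ∀ {A : Set} {n} (S : Vec A n) (e : Fin (suc n)) (b v : A) →
  insertAt S e b [ e ]≔ v ≡ insertAt S e v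
insertAt-update-self S e b v = insertAt-ext e
  (trans (VecP.lookup∘update e (insertAt S e b) v) (sym (VecP.insertAt-lookup S e v)))
  λ k → trans (VecP.lookup∘update′ (punchInᵢ≢i e k) (insertAt S e b) v)
              (trans (VecP.insertAt-punchIn S e b k) (sym (VecP.insertAt-punchIn S e v k)))

lookup-∁ : ∀ {n} (S : Subset n) (i : Fin n) → lookup (∁ S) i ≡ not (lookup S i)
lookup-∁ S i = VecP.lookup-map i not S

∁-involutive : ∀ {n} (S : Subset n) → ∁ (∁ S) ≡ S
∁-involutive S = lookup-ext λ i →
  trans (lookup-∁ (∁ S) i) (trans (cong not (lookup-∁ S i)) (not-involutive _))

∁-insertAt : ∀ {n} (S : Subset n) (e : Fin (suc n)) (b : Bool) →
  ∁ (insertAt S e b) ≡ insertAt (∁ S) e (not b)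
∁-insertAt S e b = VecP.map-insertAt not b S e

≢-by-lookup : ∀ {n} (S : Subset n) {i j : Fin n} → lookup S i ≡ true → lookup S j ≡ false → i ≢ j
≢-by-lookup S Si Sj refl = true≢false (trans (sym Si) Sj)

module _ {n} (B : Subset n) {x y : Fin n} where

  lookup-exchange-in : lookup ((B -ₛ x) +ₛ y) y ≡ true
  lookup-exchange-in = VecP.lookup∘update y (B -ₛ x) true

  lookup-exchange-out : x ≢ y → lookup ((B -ₛ x) +ₛ y) x ≡ false
  lookup-exchange-out x≢y =
    trans (VecP.lookup∘update′ x≢y (B -ₛ x) true) (VecP.lookup∘update x B false)

  lookup-exchange-other : ∀ {k} → k ≢ x → k ≢ y → lookup ((B -ₛ x) +ₛ y) k ≡ lookup B k
  lookup-exchange-other k≢x k≢y =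
    trans (VecP.lookup∘update′ k≢y (B -ₛ x) true) (VecP.lookup∘update′ k≢x B false)

countᶠ : ∀ n → (Fin n → Bool) → ℕ
countᶠ zero    p = 0
countᶠ (suc n) p = bit (p zero) + countᶠ n (p ∘ suc)

allᶠ : ∀ n → (Fin n → Bool) → Bool
allᶠ zero    p = true
allᶠ (suc n) p = p zero ∧ allᶠ n (p ∘ suc)

anyᶠ : ∀ n → (Fin n → Bool) → Bool
anyᶠ zero    p = false
anyᶠ (suc n) p = p zero ∨ anyᶠ n (p ∘ suc)

countᶠ-cong : ∀ n {p q : Fin n → Bool} → (∀ x → p x ≡ q x) → countᶠ n p ≡ countᶠ n q
countᶠ-cong zero    h = refl
countᶠ-cong (suc n) h = cong₂ _+_ (cong bit (h zero)) (countᶠ-cong n (h ∘ suc))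

allᶠ-cong : ∀ n {p q : Fin n → Bool} → (∀ x → p x ≡ q x) → allᶠ n p ≡ allᶠ n q
allᶠ-cong zero    h = refl
allᶠ-cong (suc n) h = cong₂ _∧_ (h zero) (allᶠ-cong n (h ∘ suc))

countᶠ-punchIn : ∀ n (e : Fin (suc n)) (p : Fin (suc n) → Bool) →
  countᶠ (suc n) p ≡ bit (p e) + countᶠ n (p ∘ punchIn e)
countᶠ-punchIn n       zero    p = refl
countᶠ-punchIn (suc n) (suc e) p =
  trans (cong (bit (p zero) +_) (countᶠ-punchIn n e (p ∘ suc))) (x∙yz≈y∙xz (bit (p zero)) (bit (p (suc e))) _)

allᶠ-punchIn : ∀ n (e : Fin (suc n)) (p : Fin (suc n) → Bool) →
  allᶠ (suc n) p ≡ p e ∧ allᶠ n (p ∘ punchIn e)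
allᶠ-punchIn n       zero    p = refl
allᶠ-punchIn (suc n) (suc e) p =
  trans (cong (p zero ∧_) (allᶠ-punchIn n e (p ∘ suc))) (∧-swapˡ (p zero) (p (suc e)) _)

allᶠ-sound : ∀ n {p : Fin n → Bool} → T (allᶠ n p) → ∀ x → T (p x)
allᶠ-sound (suc n) {p} t zero    = proj₁ (to (T-∧ {p zero}) t)
allᶠ-sound (suc n) {p} t (suc x) = allᶠ-sound n (proj₂ (to (T-∧ {p zero}) t)) x

allᶠ-complete : ∀ n {p : Fin n → Bool} → (∀ x → T (p x)) → T (allᶠ n p)
allᶠ-complete zero    h = tt
allᶠ-complete (suc n) h = from T-∧ (h zero , allᶠ-complete n (h ∘ suc))

anyᶠ-sound : ∀ n {p : Fin n → Bool} → T (anyᶠ n p) → ∃ λ x → T (p x)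
anyᶠ-sound (suc n) {p} t with to (T-∨ {p zero}) t
... | inj₁ t₀ = zero , t₀
... | inj₂ t′ with anyᶠ-sound n t′
... | x , tx = suc x , tx

anyᶠ-complete : ∀ n {p : Fin n → Bool} x → T (p x) → T (anyᶠ n p)
anyᶠ-complete (suc n) {p} zero    t = from (T-∨ {p zero}) (inj₁ t)
anyᶠ-complete (suc n) {p} (suc x) t = from (T-∨ {p zero}) (inj₂ (anyᶠ-complete n x t))

bit-mono : ∀ {a b} → (T a → T b) → bit a ≤ bit b
bit-mono {false}         _ = z≤n
bit-mono {true}  {true}  _ = ≤-refl
bit-mono {true}  {false} f = ⊥-elim (f tt)

countᶠ-mono : ∀ n {p q : Fin n → Bool} → (∀ x → T (p x) → T (q x)) → countᶠ n p ≤ countᶠ n q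
countᶠ-mono zero    h = z≤n
countᶠ-mono (suc n) h = +-mono-≤ (bit-mono (h zero)) (countᶠ-mono n (h ∘ suc))

countᶠ-mono-< : ∀ n {p q : Fin n → Bool} (w : Fin n) → (∀ x → T (p x) → T (q x)) →
  p w ≡ false → q w ≡ true → countᶠ n p < countᶠ n q
countᶠ-mono-< (suc n) zero h pw qw rewrite pw | qw = s≤s (countᶠ-mono n (h ∘ suc))
countᶠ-mono-< (suc n) {p} {q} (suc w) h pw qw =
  subst (_≤ bit (q zero) + countᶠ n (q ∘ suc)) (+-suc (bit (p zero)) _)
        (+-mono-≤ (bit-mono (h zero)) (countᶠ-mono-< n w (h ∘ suc) pw qw))

count-cong : ∀ {A : Set} {p q : A → Bool} (xs : List A) → (∀ x → p x ≡ q x) → count p xs ≡ count q xs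
count-cong []       h = refl
count-cong {q = q} (x ∷ xs) h rewrite h x with q x
... | true  = cong suc (count-cong xs h)
... | false = count-cong xs h

count-++ : ∀ {A : Set} (p : A → Bool) (xs ys : List A) → count p (xs ++ ys) ≡ count p xs + count p ys
count-++ p []       ys = refl
count-++ p (x ∷ xs) ys with p x
... | true  = cong suc (count-++ p xs ys)
... | false = count-++ p xs ys

count-map : ∀ {A B : Set} (p : B → Bool) (g : A → B) (xs : List A) →
  count p (mapᴸ g xs) ≡ count (p ∘ g) xs
count-map p g []       = refl
count-map p g (x ∷ xs) with p (g x)
... | true  = cong suc (count-map p g xs)
... | false = count-map p g xs

count-false : ∀ {A : Set} (xs : List A) → count (λ _ → false) xs ≡ 0
count-false []       = refl
count-false (x ∷ xs) = count-false xs

count-witness : ∀ {A : Set} (p : A → Bool) (xs : List A) → count p xs ≢ 0 → ∃ λ x → T (p x)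
count-witness p []       h = ⊥-elim (h refl)
count-witness p (x ∷ xs) h with p x in eq
... | true  = x , subst T (sym eq) tt
... | false = count-witness p xs h

count-∨ : ∀ {A : Set} (xs : List A) (p q : A → Bool) → (∀ x → T (p x) → T (q x) → ⊥) →
  count (λ x → p x ∨ q x) xs ≡ count p xs + count q xs
count-∨ []       p q disjoint = refl
count-∨ (x ∷ xs) p q disjoint with p x in px | q x in qx
... | true  | true  = ⊥-elim (disjoint x (subst T (sym px) tt) (subst T (sym qx) tt))
... | true  | false = cong suc (count-∨ xs p q disjoint)
... | false | true  = trans (cong suc (count-∨ xs p q disjoint)) (sym (+-suc _ _))
... | false | false = count-∨ xs p q disjoint

countˢ : ∀ n → (Subset n → Bool) → ℕ
countˢ n p = count p (allSubsets n)

countˢ-suc : ∀ n (p : Subset (suc n) → Bool) →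
  countˢ (suc n) p ≡ countˢ n (p ∘ (true ∷_)) + countˢ n (p ∘ (false ∷_))
countˢ-suc n p = trans (count-++ p (mapᴸ (true ∷_) (allSubsets n)) _)
                       (cong₂ _+_ (count-map p _ (allSubsets n)) (count-map p _ (allSubsets n)))

countˢ-cong : ∀ n {p q : Subset n → Bool} → (∀ S → p S ≡ q S) → countˢ n p ≡ countˢ n q
countˢ-cong n = count-cong (allSubsets n)

countˢ-insertAt : ∀ n (e : Fin (suc n)) (p : Subset (suc n) → Bool) →
  countˢ (suc n) p ≡ countˢ n (λ S → p (insertAt S e false)) + countˢ n (λ S → p (insertAt S e true))
countˢ-insertAt n       zero    p = trans (countˢ-suc n p) (+-comm (countˢ n (p ∘ (true ∷_))) _)
countˢ-insertAt (suc n) (suc e) p = begin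
  countˢ (suc (suc n)) p
    ≡⟨ countˢ-suc (suc n) p ⟩
  countˢ (suc n) (p ∘ (true ∷_)) + countˢ (suc n) (p ∘ (false ∷_))
    ≡⟨ cong₂ _+_ (countˢ-insertAt n e (p ∘ (true ∷_))) (countˢ-insertAt n e (p ∘ (false ∷_))) ⟩
  (c true false + c true true) + (c false false + c false true)
    ≡⟨ interchange (c true false) (c true true) (c false false) (c false true) ⟩
  (c true false + c false false) + (c true true + c false true)
    ≡⟨ cong₂ _+_ (countˢ-suc n (λ S → p (insertAt S (suc e) false)))
                 (countˢ-suc n (λ S → p (insertAt S (suc e) true))) ⟨
  countˢ (suc n) (λ S → p (insertAt S (suc e) false)) + countˢ (suc n) (λ S → p (insertAt S (suc e) true)) ∎
  where
  open ≡-Reasoning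
  c : Bool → Bool → ℕ
  c a b = countˢ n (λ S → p (a ∷ insertAt S e b))

countˢ-∁ : ∀ n (p : Subset n → Bool) → countˢ n (p ∘ ∁) ≡ countˢ n p
countˢ-∁ zero    p = refl
countˢ-∁ (suc n) p =
  trans (countˢ-suc n (p ∘ ∁))
        (trans (cong₂ _+_ (countˢ-∁ n (p ∘ (false ∷_))) (countˢ-∁ n (p ∘ (true ∷_))))
               (trans (+-comm (countˢ n (p ∘ (false ∷_))) _) (sym (countˢ-suc n p))))

countˢ-witness : ∀ n (p : Subset n → Bool) (S : Subset n) → T (p S) → countˢ n p ≢ 0
countˢ-witness zero    p [] t with p []
... | true = λ ()
countˢ-witness (suc n) p (true ∷ S) t c≡0 =
  countˢ-witness n (p ∘ (true ∷_)) S t (m+n≡0⇒m≡0 _ (trans (sym (countˢ-suc n p)) c≡0))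
countˢ-witness (suc n) p (false ∷ S) t c≡0 =
  countˢ-witness n (p ∘ (false ∷_)) S t (m+n≡0⇒n≡0 _ (trans (sym (countˢ-suc n p)) c≡0))

none : ∀ {n} → (Subset n → Bool) → Bool
none {n} f = countˢ n f ≡ᵇ 0

none-false⇒witness : ∀ {n} (f : Subset n → Bool) → none f ≡ false → ∃ λ S → T (f S)
none-false⇒witness {n} f h =
  count-witness f (allSubsets n) λ c≡0 → true≢false (trans (sym (cong (_≡ᵇ 0) c≡0)) h)

none-true⇒false : ∀ {n} (f : Subset n → Bool) → none f ≡ true → ∀ S → f S ≡ false
none-true⇒false {n} f h S with f S in fS
... | false = refl
... | true  = ⊥-elim (countˢ-witness n f S (subst T (sym fS) tt) (≡ᵇ⇒≡ _ 0 (subst T (sym h) tt)))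

witness⇒none-false : ∀ {n} (f : Subset n → Bool) S → T (f S) → none f ≡ false
witness⇒none-false {n} f S t with countˢ n f in c
... | zero  = ⊥-elim (countˢ-witness n f S t c)
... | suc _ = refl

none-cong : ∀ {n} {f g : Subset n → Bool} → (∀ S → f S ≡ g S) → none f ≡ none g
none-cong {n} h = cong (_≡ᵇ 0) (countˢ-cong n h)

none-∁ : ∀ {n} (f : Subset n → Bool) → none (f ∘ ∁) ≡ none f
none-∁ {n} f = cong (_≡ᵇ 0) (countˢ-∁ n f)

-- `minor e b f` lists the members of f with e-th coordinate b, on the remaining
-- coordinates: for b = false the deletion of e (unless e is a coloop), for
-- b = true the contraction of e (unless e is a loop).
minor : ∀ {n} → Fin (suc n) → Bool → (Subset (suc n) → Bool) → Subset n → Bool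
minor e b f S = f (insertAt S e b)

none-insertAt : ∀ n (e : Fin (suc n)) (f : Subset (suc n) → Bool) →
  none f ≡ none (minor e false f) ∧ none (minor e true f)
none-insertAt n e f = trans (cong (_≡ᵇ 0) (countˢ-insertAt n e f)) (+≡ᵇ0 (countˢ n (minor e false f)) _)
  where
  +≡ᵇ0 : ∀ a b → (a + b ≡ᵇ 0) ≡ (a ≡ᵇ 0) ∧ (b ≡ᵇ 0)
  +≡ᵇ0 zero    b = refl
  +≡ᵇ0 (suc a) b = refl

Exchange : ∀ n → (Subset n → Bool) → Set
Exchange n f = ∀ B₁ B₂ → T (f B₁) → T (f B₂) → ∀ x → lookup B₁ x ≡ true → lookup B₂ x ≡ false →
  ∃ λ y → lookup B₂ y ≡ true × lookup B₁ y ≡ false × T (f ((B₁ -ₛ x) +ₛ y))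

isMatroid⇒exchange : ∀ {n} (𝓑 : PreMatroid n) → IsMatroid 𝓑 → Exchange n (isBasis 𝓑)
isMatroid⇒exchange 𝓑 isM B₁ B₂ b₁ b₂ x B₁x B₂x
  with isM B₁ B₂ b₁ b₂ x (VecP.lookup⇒[]= x B₁ B₁x)
                         (λ x∈B₂ → true≢false (trans (sym (VecP.[]=⇒lookup x∈B₂)) B₂x))
... | y , y∈B₂ , y∉B₁ , b′ = y , VecP.[]=⇒lookup y∈B₂ , ¬-not (y∉B₁ ∘ VecP.lookup⇒[]= y B₁) , b′

exchange-minor : ∀ n {f : Subset (suc n) → Bool} (e : Fin (suc n)) (b : Bool) →
  Exchange (suc n) f → Exchange n (minor e b f)
exchange-minor n {f} e b exch B₁ B₂ b₁ b₂ x B₁x B₂x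
  with exch (insertAt B₁ e b) (insertAt B₂ e b) b₁ b₂ (punchIn e x)
            (trans (VecP.insertAt-punchIn B₁ e b x) B₁x) (trans (VecP.insertAt-punchIn B₂ e b x) B₂x)
... | y , B₂y , B₁y , b′ with ≡-or-punchIn e y
... | inj₁ refl = ⊥-elim (true≢false (begin
        true                       ≡⟨ B₂y ⟨
        lookup (insertAt B₂ e b) e ≡⟨ VecP.insertAt-lookup B₂ e b ⟩
        b                          ≡⟨ VecP.insertAt-lookup B₁ e b ⟨
        lookup (insertAt B₁ e b) e ≡⟨ B₁y ⟩
        false                      ∎))
  where open ≡-Reasoning
... | inj₂ (y′ , refl) =
  y′ , trans (sym (VecP.insertAt-punchIn B₂ e b y′)) B₂y , trans (sym (VecP.insertAt-punchIn B₁ e b y′)) B₁y ,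
  subst (T ∘ f) (trans (cong (_+ₛ punchIn e y′) (insertAt-update-punchIn B₁ e b false x))
                       (insertAt-update-punchIn (B₁ -ₛ x) e b true y′)) b′

dist : ∀ {n} → Subset n → Subset n → ℕ
dist {n} B C = countᶠ n (λ i → lookup B i ∧ not (lookup C i))

dist-exchange-< : ∀ {n} (B C : Subset n) {x y} → lookup B x ≡ true → lookup C x ≡ false →
  lookup B y ≡ false → lookup C y ≡ true → dist ((B -ₛ x) +ₛ y) C < dist B C
dist-exchange-< {n} B C {x} {y} Bx Cx By Cy =
  countᶠ-mono-< n x smaller (cong (_∧ not (lookup C x)) (lookup-exchange-out B x≢y))
                            (cong₂ _∧_ Bx (cong not Cx))
  where
  x≢y : x ≢ y
  x≢y = ≢-by-lookup B Bx By
  smaller : ∀ i → T (lookup ((B -ₛ x) +ₛ y) i ∧ not (lookup C i)) → T (lookup B i ∧ not (lookup C i))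
  smaller i t with i ≟ᶠ y | i ≟ᶠ x
  ... | yes refl | _        = ⊥-elim (subst (T ∘ not) Cy (proj₂ (to T-∧ t)))
  ... | no _     | yes refl = ⊥-elim (subst (λ b → T (b ∧ _)) (lookup-exchange-out B x≢y) t)
  ... | no i≢y   | no i≢x   = subst (λ b → T (b ∧ _)) (lookup-exchange-other B i≢x i≢y) t

∉-+ₛ : ∀ {n} (S : Subset n) {x w} → lookup (S +ₛ x) w ≡ false → w ≢ x × lookup S w ≡ false
∉-+ₛ S {x} {w} w∉S+x with w ≟ᶠ x
... | yes refl = ⊥-elim (true≢false (trans (sym (VecP.lookup∘update w S true)) w∉S+x))
... | no w≢x   = w≢x , trans (sym (VecP.lookup∘update′ w≢x S true)) w∉S+x

outside-or-⊆ : ∀ {n} (B C : Subset n) →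
  (∃ λ x → lookup B x ≡ true × lookup C x ≡ false) ⊎ (∀ x → lookup B x ≡ true → lookup C x ≡ true)
outside-or-⊆ B C with any? (λ x → (lookup B x ≟ᵇ true) ×-dec (lookup C x ≟ᵇ false))
... | yes found = inj₁ found
... | no  ¬found = inj₂ λ x Bx → ¬-not λ Cx≡false → ¬found (x , Bx , Cx≡false)

exchange-⊆⇒≡ : ∀ {n} {f : Subset n → Bool} → Exchange n f → ∀ {B C} → T (f B) → T (f C) →
  (∀ x → lookup B x ≡ true → lookup C x ≡ true) → B ≡ C
exchange-⊆⇒≡ exch {B} {C} b c B⊆C = lookup-ext pointwise
  where
  pointwise : ∀ x → lookup B x ≡ lookup C x
  pointwise x with lookup B x in Bx | lookup C x in Cx
  ... | true  | true  = refl
  ... | true  | false = ⊥-elim (true≢false (trans (sym (B⊆C x Bx)) Cx))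
  ... | false | false = refl
  ... | false | true with exch C B c b x Cx Bx
  ...   | y , By , Cy , _ = ⊥-elim (true≢false (trans (sym (B⊆C y By)) Cy))

module _ {n} {f : Subset n → Bool} (exch : Exchange n f) where

  exchange-insert : ∀ {B₁ B₃ x} → T (f B₁) → T (f B₃) → lookup B₁ x ≡ false → lookup B₃ x ≡ true →
    ∃ λ y → lookup B₁ y ≡ true × T (f ((B₁ -ₛ y) +ₛ x))
  exchange-insert {B₁} {B₃} {x} b₁ b₃ B₁x B₃x = go B₃ (<-wellFounded (dist B₃ B₁)) b₃ B₃x
    where
    -- Move B towards B₁ while keeping x, until B ⊆ B₁ + x; then B₁ and B differ by
    -- one element on each side, and one of them is x.
    go : ∀ B → Acc _<_ (dist B B₁) → T (f B) → lookup B x ≡ true →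
         ∃ λ y → lookup B₁ y ≡ true × T (f ((B₁ -ₛ y) +ₛ x))
    go B (acc smaller) b Bx with outside-or-⊆ B (B₁ +ₛ x)
    ... | inj₁ (w , Bw , w∉B₁+x) with ∉-+ₛ B₁ w∉B₁+x
    ... | w≢x , B₁w with exch B B₁ b b₁ w Bw B₁w
    ... | z , B₁z , Bz , b′ =
      go ((B -ₛ w) +ₛ z) (smaller (dist-exchange-< B B₁ Bw B₁w Bz B₁z)) b′
         (trans (lookup-exchange-other B (w≢x ∘ sym) (≢-by-lookup B₁ B₁z B₁x ∘ sym)) Bx)
    go B _ b Bx | inj₂ B⊆B₁+x with exch B B₁ b b₁ x Bx B₁x
    ... | y , B₁y , By , _ with exch B₁ B b₁ b y B₁y By
    ... | z , Bz , B₁z , b′ with z ≟ᶠ x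
    ... | yes refl = y , B₁y , b′
    ... | no z≢x = ⊥-elim (true≢false (begin
            true                  ≡⟨ B⊆B₁+x z Bz ⟨
            lookup (B₁ +ₛ x) z    ≡⟨ VecP.lookup∘update′ z≢x B₁ true ⟩
            lookup B₁ z           ≡⟨ B₁z ⟩
            false                 ∎))
      where open ≡-Reasoning

  exchange-connected : (P : Subset n → Set) →
    (∀ {B x y} → T (f B) → lookup B x ≡ true → lookup B y ≡ false →
       T (f ((B -ₛ x) +ₛ y)) → P B → P ((B -ₛ x) +ₛ y)) →
    ∀ {B₁ B₂} → T (f B₁) → T (f B₂) → P B₁ → P B₂
  exchange-connected P step {B₁} {B₂} b₁ b₂ = go B₁ (<-wellFounded (dist B₁ B₂)) b₁
    where
    go : ∀ B → Acc _<_ (dist B B₂) → T (f B) → P B → P B₂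
    go B (acc smaller) b PB with outside-or-⊆ B B₂
    ... | inj₂ B⊆B₂ = subst P (exchange-⊆⇒≡ exch b b₂ B⊆B₂) PB
    ... | inj₁ (x , Bx , B₂x) with exch B B₂ b b₂ x Bx B₂x
    ... | y , B₂y , By , b′ =
      go ((B -ₛ x) +ₛ y) (smaller (dist-exchange-< B B₂ Bx B₂x By B₂y)) b′ (step b Bx By b′ PB)

-- Internal and external activity

completes : ∀ {n} → (Subset n → Bool) → Subset n → Fin n → Bool
completes f D y = not (lookup D y) ∧ f (D +ₛ y)

-- φ_ω(B - x) = B, for r = rank ω
isActive : ∀ {n} → (Subset n → Bool) → (Fin n → ℕ) → Subset n → Fin n → Bool
isActive {n} f r B x = allᶠ n (λ y → completes f (B -ₛ x) y ⇒ᵇ (r x ≤ᵇ r y))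

internalActivity : ∀ n → (Subset n → Bool) → (Fin n → ℕ) → Subset n → ℕ
internalActivity n f r B = countᶠ n (λ x → lookup B x ∧ isActive f r B x)

dual : ∀ {n} → (Subset n → Bool) → Subset n → Bool
dual f = f ∘ ∁

-- The external activity of B is the internal activity of ∁ B in the dual family.
activityCount : ∀ n → (Subset n → Bool) → (Fin n → ℕ) → (ℕ → ℕ → Bool) → ℕ
activityCount n f r h =
  countˢ n (λ B → f B ∧ h (internalActivity n f r B) (internalActivity n (dual f) r (∁ B)))

isLoop isColoop : ∀ {n} → Fin (suc n) → (Subset (suc n) → Bool) → Bool
isLoop   e f = none (minor e true f)
isColoop e f = none (minor e false f)

shiftⁱ shiftᵉ : Bool → (ℕ → ℕ → Bool) → ℕ → ℕ → Bool
shiftⁱ b h i j = h (bit b + i) j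
shiftᵉ b h i j = h i (bit b + j)

internalActivity-cong : ∀ n {f g : Subset n → Bool} r B → (∀ S → f S ≡ g S) →
  internalActivity n f r B ≡ internalActivity n g r B
internalActivity-cong n r B f≗g = countᶠ-cong n λ x → cong (lookup B x ∧_) (allᶠ-cong n λ y →
  cong (λ b → (not (lookup (B -ₛ x) y) ∧ b) ⇒ᵇ (r x ≤ᵇ r y)) (f≗g _))

completes-insertAt : ∀ {n} (f : Subset (suc n) → Bool) (e : Fin (suc n)) (b : Bool) (D : Subset n) (y : Fin n) →
  completes f (insertAt D e b) (punchIn e y) ≡ completes (minor e b f) D y
completes-insertAt f e b D y =
  cong₂ _∧_ (cong not (VecP.insertAt-punchIn D e b y)) (cong f (insertAt-update-punchIn D e b true y))

⇒ᵇ-true : ∀ a → (a ⇒ᵇ true) ≡ true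
⇒ᵇ-true true  = refl
⇒ᵇ-true false = refl

⇒ᵇ-false : ∀ a → (a ⇒ᵇ false) ≡ not a
⇒ᵇ-false true  = refl
⇒ᵇ-false false = refl

⇒ᵇ-intro : ∀ {a b} → (T a → T b) → T (a ⇒ᵇ b)
⇒ᵇ-intro {false}         _ = tt
⇒ᵇ-intro {true}  {true}  _ = tt
⇒ᵇ-intro {true}  {false} h = h tt

≤ᵇ-false : ∀ {a b} → b < a → (a ≤ᵇ b) ≡ false
≤ᵇ-false {a} {b} b<a with a ≤ᵇ b in a≤ᵇb
... | false = refl
... | true  = ⊥-elim (<⇒≱ b<a (≤ᵇ⇒≤ a b (subst T (sym a≤ᵇb) tt)))

-- When e has the largest rank, it never obstructs the activity of another element.
internalActivity-insertAt : ∀ n (f : Subset (suc n) → Bool) (r : Fin (suc n) → ℕ) (e : Fin (suc n))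
  (b : Bool) (S : Subset n) → (∀ j → r (punchIn e j) ≤ r e) →
  internalActivity (suc n) f r (insertAt S e b)
    ≡ bit (b ∧ isActive f r (insertAt S e b) e) + internalActivity n (minor e b f) (r ∘ punchIn e) S
internalActivity-insertAt n f r e b S e-max =
  trans (countᶠ-punchIn n e (λ x → lookup B x ∧ isActive f r B x))
        (cong₂ _+_ (cong (λ c → bit (c ∧ isActive f r B e)) (VecP.insertAt-lookup S e b))
                   (countᶠ-cong n λ j → cong₂ _∧_ (VecP.insertAt-punchIn S e b j) (active j)))
  where
  B : Subset (suc n)
  B = insertAt S e b
  active : ∀ j → isActive f r B (punchIn e j) ≡ isActive (minor e b f) (r ∘ punchIn e) S j
  active j = trans (allᶠ-punchIn n e (λ y → completes f (B -ₛ punchIn e j) y ⇒ᵇ (r (punchIn e j) ≤ᵇ r y)))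
    (cong₂ _∧_ (trans (cong (_ ⇒ᵇ_) (to T-≡ (≤⇒≤ᵇ (e-max j)))) (⇒ᵇ-true _))
               (allᶠ-cong n λ y → cong (_⇒ᵇ (r (punchIn e j) ≤ᵇ r (punchIn e y)))
                  (trans (cong (λ V → completes f V (punchIn e y)) (insertAt-update-punchIn S e b false j))
                         (completes-insertAt f e b (S -ₛ j) y))))

-- The exchange property at a single element, in the weak form that is all the
-- dual family is shown to have.
ExchangeAt : ∀ {n} → (Subset (suc n) → Bool) → Fin (suc n) → Set
ExchangeAt {n} f e = ∀ B C → T (f B) → T (f C) → lookup B e ≡ true → lookup C e ≡ false →
  ∃ λ y → y ≢ e × lookup B y ≡ false × T (f ((B -ₛ e) +ₛ y))

exchange⇒exchangeAt : ∀ {n} {f : Subset (suc n) → Bool} → Exchange (suc n) f → ∀ e → ExchangeAt f e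
exchange⇒exchangeAt exch e B C b c Be Ce with exch B C b c e Be Ce
... | y , Cy , By , b′ = y , ≢-by-lookup C Cy Ce , By , b′

-- Via complements, exchanging e out of ∁ B is exchanging some y into B.
exchange⇒dual-exchangeAt : ∀ {n} {f : Subset (suc n) → Bool} → Exchange (suc n) f → ∀ e → ExchangeAt (dual f) e
exchange⇒dual-exchangeAt {f = f} exch e B C b c Be Ce
  with exchange-insert exch b c (trans (lookup-∁ B e) (cong not Be)) (trans (lookup-∁ C e) (cong not Ce))
... | y , ∁By , b′ = y , y≢e , By , subst (T ∘ f) (sym ∁-exchange) b′
  where
  y≢e : y ≢ e
  y≢e = ≢-by-lookup (∁ B) ∁By (trans (lookup-∁ B e) (cong not Be))
  By : lookup B y ≡ false
  By = trans (sym (not-involutive _)) (cong not (trans (sym (lookup-∁ B y)) ∁By))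
  ∁-exchange : ∁ ((B -ₛ e) +ₛ y) ≡ (∁ B -ₛ y) +ₛ e
  ∁-exchange = lookup-ext λ k → trans (lookup-∁ ((B -ₛ e) +ₛ y) k) (pointwise k)
    where
    pointwise : ∀ k → not (lookup ((B -ₛ e) +ₛ y) k) ≡ lookup ((∁ B -ₛ y) +ₛ e) k
    pointwise k with k ≟ᶠ y | k ≟ᶠ e
    ... | yes refl | _        = trans (cong not (lookup-exchange-in B))
                                      (sym (lookup-exchange-out (∁ B) y≢e))
    ... | no k≢y   | yes refl = trans (cong not (lookup-exchange-out B (y≢e ∘ sym)))
                                      (sym (lookup-exchange-in (∁ B)))
    ... | no k≢y   | no k≢e   = trans (cong not (lookup-exchange-other B k≢e k≢y))
                                      (sym (trans (lookup-exchange-other (∁ B) k≢y k≢e) (lookup-∁ B k)))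

nothing-completes⇔coloop : ∀ n (f : Subset (suc n) → Bool) (e : Fin (suc n)) (S : Subset n) →
  ExchangeAt f e → T (f (insertAt S e true)) →
  allᶠ n (not ∘ completes (minor e false f) S) ≡ isColoop e f
nothing-completes⇔coloop n f e S exch-e b = T-ext ⇒coloop coloop⇒
  where
  ⇒coloop : T (allᶠ n (not ∘ completes (minor e false f) S)) → T (isColoop e f)
  ⇒coloop nothing with isColoop e f in coloop
  ... | true  = tt
  ... | false with none-false⇒witness (minor e false f) coloop
  ... | S′ , c with exch-e (insertAt S e true) (insertAt S′ e false) b c
                          (VecP.insertAt-lookup S e true) (VecP.insertAt-lookup S′ e false)
  ... | y , y≢e , By , b′ with ≡-or-punchIn e y
  ... | inj₁ y≡e = ⊥-elim (y≢e y≡e)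
  ... | inj₂ (y′ , refl) = subst (T ∘ not) completes-y′ (allᶠ-sound n nothing y′)
    where
    completes-y′ : completes (minor e false f) S y′ ≡ true
    completes-y′ = cong₂ _∧_ (cong not (trans (sym (VecP.insertAt-punchIn S e true y′)) By))
      (to T-≡ (subst (T ∘ f) (trans (cong (_+ₛ punchIn e y′) (insertAt-update-self S e true false))
                                    (insertAt-update-punchIn S e false true y′)) b′))
  coloop⇒ : T (isColoop e f) → T (allᶠ n (not ∘ completes (minor e false f) S))
  coloop⇒ coloop = allᶠ-complete n λ y → subst (T ∘ not)
    (sym (trans (cong (not (lookup S y) ∧_) (none-true⇒false (minor e false f) (to T-≡ coloop) (S +ₛ y)))
                (∧-zeroʳ _)))
    tt

internalActivity-deletion : ∀ n (f : Subset (suc n) → Bool) (r : Fin (suc n) → ℕ) (e : Fin (suc n))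
  (S : Subset n) → (∀ j → r (punchIn e j) ≤ r e) →
  internalActivity (suc n) f r (insertAt S e false) ≡ internalActivity n (minor e false f) (r ∘ punchIn e) S
internalActivity-deletion n f r e = internalActivity-insertAt n f r e false

internalActivity-contraction : ∀ n (f : Subset (suc n) → Bool) (r : Fin (suc n) → ℕ) (e : Fin (suc n))
  (S : Subset n) → (∀ j → r (punchIn e j) < r e) → ExchangeAt f e → T (f (insertAt S e true)) →
  internalActivity (suc n) f r (insertAt S e true)
    ≡ bit (isColoop e f) + internalActivity n (minor e true f) (r ∘ punchIn e) S
internalActivity-contraction n f r e S e-max exch-e b =
  trans (internalActivity-insertAt n f r e true S (<⇒≤ ∘ e-max))
        (cong (λ c → bit c + internalActivity n (minor e true f) (r ∘ punchIn e) S) e-active)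
  where
  B : Subset (suc n)
  B = insertAt S e true
  e-active : isActive f r B e ≡ isColoop e f
  e-active = begin
    isActive f r B e
      ≡⟨ allᶠ-punchIn n e (λ y → completes f (B -ₛ e) y ⇒ᵇ (r e ≤ᵇ r y)) ⟩
    (completes f (B -ₛ e) e ⇒ᵇ (r e ≤ᵇ r e))
      ∧ allᶠ n (λ y → completes f (B -ₛ e) (punchIn e y) ⇒ᵇ (r e ≤ᵇ r (punchIn e y)))
      ≡⟨ cong₂ _∧_ (trans (cong (_ ⇒ᵇ_) (to T-≡ (≤⇒≤ᵇ (≤-refl {r e})))) (⇒ᵇ-true _))
                   (allᶠ-cong n λ y → trans (cong₂ _⇒ᵇ_ (completes-B-e y) (≤ᵇ-false (e-max y))) (⇒ᵇ-false _)) ⟩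
    allᶠ n (not ∘ completes (minor e false f) S)
      ≡⟨ nothing-completes⇔coloop n f e S exch-e b ⟩
    isColoop e f ∎
    where
    open ≡-Reasoning
    completes-B-e : ∀ y → completes f (B -ₛ e) (punchIn e y) ≡ completes (minor e false f) S y
    completes-B-e y = trans (cong (λ V → completes f V (punchIn e y)) (insertAt-update-self S e true false))
                            (completes-insertAt f e false S y)

dual-insertAt : ∀ {n} (f : Subset (suc n) → Bool) (e : Fin (suc n)) (b : Bool) (S : Subset n) →
  dual f (insertAt S e b) ≡ minor e (not b) f (∁ S)
dual-insertAt f e b S = cong f (∁-insertAt S e b)

externalActivity-deletion : ∀ n (f : Subset (suc n) → Bool) (r : Fin (suc n) → ℕ) (e : Fin (suc n))
  (S : Subset n) → Exchange (suc n) f → (∀ j → r (punchIn e j) < r e) → T (f (insertAt S e false)) →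
  internalActivity (suc n) (dual f) r (∁ (insertAt S e false))
    ≡ bit (isLoop e f) + internalActivity n (dual (minor e false f)) (r ∘ punchIn e) (∁ S)
externalActivity-deletion n f r e S exch e-max b = begin
  internalActivity (suc n) (dual f) r (∁ (insertAt S e false))
    ≡⟨ cong (internalActivity (suc n) (dual f) r) (∁-insertAt S e false) ⟩
  internalActivity (suc n) (dual f) r (insertAt (∁ S) e true)
    ≡⟨ internalActivity-contraction n (dual f) r e (∁ S) e-max (exchange⇒dual-exchangeAt exch e) b* ⟩
  bit (isColoop e (dual f)) + internalActivity n (minor e true (dual f)) (r ∘ punchIn e) (∁ S)
    ≡⟨ cong₂ _+_ (cong bit (trans (none-cong (dual-insertAt f e false)) (none-∁ (minor e true f))))
                 (internalActivity-cong n (r ∘ punchIn e) (∁ S) (dual-insertAt f e true)) ⟩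
  bit (isLoop e f) + internalActivity n (dual (minor e false f)) (r ∘ punchIn e) (∁ S) ∎
  where
  open ≡-Reasoning
  b* : T (dual f (insertAt (∁ S) e true))
  b* = subst (T ∘ f) (sym (trans (∁-insertAt (∁ S) e true) (cong (λ V → insertAt V e false) (∁-involutive S)))) b

externalActivity-contraction : ∀ n (f : Subset (suc n) → Bool) (r : Fin (suc n) → ℕ) (e : Fin (suc n))
  (S : Subset n) → (∀ j → r (punchIn e j) ≤ r e) →
  internalActivity (suc n) (dual f) r (∁ (insertAt S e true))
    ≡ internalActivity n (dual (minor e true f)) (r ∘ punchIn e) (∁ S)
externalActivity-contraction n f r e S e-max = begin
  internalActivity (suc n) (dual f) r (∁ (insertAt S e true))
    ≡⟨ cong (internalActivity (suc n) (dual f) r) (∁-insertAt S e true) ⟩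
  internalActivity (suc n) (dual f) r (insertAt (∁ S) e false)
    ≡⟨ internalActivity-deletion n (dual f) r e (∁ S) e-max ⟩
  internalActivity n (minor e false (dual f)) (r ∘ punchIn e) (∁ S)
    ≡⟨ internalActivity-cong n (r ∘ punchIn e) (∁ S) (dual-insertAt f e false) ⟩
  internalActivity n (dual (minor e true f)) (r ∘ punchIn e) (∁ S) ∎
  where open ≡-Reasoning

-- Expanding at the element of largest rank: deleting it from B adds a loop to the
-- external activity, contracting it adds a coloop to the internal activity.
activityCount-expand : ∀ n (f : Subset (suc n) → Bool) (r : Fin (suc n) → ℕ) (e : Fin (suc n)) →
  Exchange (suc n) f → (∀ j → r (punchIn e j) < r e) → ∀ h →
  activityCount (suc n) f r h
    ≡ activityCount n (minor e false f) (r ∘ punchIn e) (shiftᵉ (isLoop e f) h)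
    + activityCount n (minor e true f) (r ∘ punchIn e) (shiftⁱ (isColoop e f) h)
activityCount-expand n f r e exch e-max h =
  trans (countˢ-insertAt n e _) (cong₂ _+_ (countˢ-cong n without-e) (countˢ-cong n with-e))
  where
  without-e : ∀ S →
    (f (insertAt S e false) ∧ h (internalActivity (suc n) f r (insertAt S e false))
                                (internalActivity (suc n) (dual f) r (∁ (insertAt S e false))))
    ≡ (minor e false f S ∧ shiftᵉ (isLoop e f) h (internalActivity n (minor e false f) (r ∘ punchIn e) S)
                                                 (internalActivity n (dual (minor e false f)) (r ∘ punchIn e) (∁ S)))
  without-e S = ∧-congˡ-T (f (insertAt S e false)) λ b → cong₂ h
    (internalActivity-deletion n f r e S (<⇒≤ ∘ e-max)) (externalActivity-deletion n f r e S exch e-max b)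
  with-e : ∀ S →
    (f (insertAt S e true) ∧ h (internalActivity (suc n) f r (insertAt S e true))
                               (internalActivity (suc n) (dual f) r (∁ (insertAt S e true))))
    ≡ (minor e true f S ∧ shiftⁱ (isColoop e f) h (internalActivity n (minor e true f) (r ∘ punchIn e) S)
                                                  (internalActivity n (dual (minor e true f)) (r ∘ punchIn e) (∁ S)))
  with-e S = ∧-congˡ-T (f (insertAt S e true)) λ b → cong₂ h
    (internalActivity-contraction n f r e S e-max (exchange⇒exchangeAt exch e) b)
    (externalActivity-contraction n f r e S (<⇒≤ ∘ e-max))

-- Deletion–contraction without an order

tutteCount : ∀ n → (Subset n → Bool) → (ℕ → ℕ → Bool) → ℕ
tutteCount zero    f h = bit (f [] ∧ h 0 0)
tutteCount (suc n) f h =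
  tutteCount n (minor zero false f) (shiftᵉ (isLoop zero f) h)
  + tutteCount n (minor zero true f) (shiftⁱ (isColoop zero f) h)

tutteCount-cong : ∀ n {f g : Subset n → Bool} {h h′ : ℕ → ℕ → Bool} →
  (∀ S → f S ≡ g S) → (∀ i j → h i j ≡ h′ i j) → tutteCount n f h ≡ tutteCount n g h′
tutteCount-cong zero    f≗g h≗h′ = cong bit (cong₂ _∧_ (f≗g []) (h≗h′ 0 0))
tutteCount-cong (suc n) {f} {g} {h} {h′} f≗g h≗h′ = cong₂ _+_
  (tutteCount-cong n (f≗g ∘ insertAt′ false)
     λ i j → trans (h≗h′ i _) (cong (λ b → h′ i (bit b + j)) (none-cong (f≗g ∘ insertAt′ true))))
  (tutteCount-cong n (f≗g ∘ insertAt′ true)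
     λ i j → trans (h≗h′ _ j) (cong (λ b → h′ (bit b + i) j) (none-cong (f≗g ∘ insertAt′ false))))
  where
  insertAt′ : Bool → Subset n → Subset (suc n)
  insertAt′ b S = insertAt S zero b

tutteCount-none : ∀ n (f : Subset n → Bool) h → (∀ S → f S ≡ false) → tutteCount n f h ≡ 0
tutteCount-none zero    f h f≗false rewrite f≗false [] = refl
tutteCount-none (suc n) f h f≗false =
  cong₂ _+_ (tutteCount-none n _ _ (λ S → f≗false _)) (tutteCount-none n _ _ (λ S → f≗false _))

vanish : ∀ {t : (ℕ → ℕ → Bool) → ℕ} → (∀ k → t k ≡ 0) → ∀ {k k′} → t k ≡ t k′
vanish t≡0 = trans (t≡0 _) (sym (t≡0 _))

module _ (t₀₀ t₀₁ t₁₀ t₁₁ : (ℕ → ℕ → Bool) → ℕ) where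

  private
    aligned : ∀ {k₀₀ k₀₀′ k₀₁ k₀₁′ k₁₀ k₁₀′ k₁₁ k₁₁′} →
      t₀₀ k₀₀ ≡ t₀₀ k₀₀′ → t₀₁ k₀₁ ≡ t₀₁ k₀₁′ → t₁₀ k₁₀ ≡ t₁₀ k₁₀′ → t₁₁ k₁₁ ≡ t₁₁ k₁₁′ →
      (t₀₀ k₀₀ + t₀₁ k₀₁) + (t₁₀ k₁₀ + t₁₁ k₁₁) ≡ (t₀₀ k₀₀′ + t₁₀ k₁₀′) + (t₀₁ k₀₁′ + t₁₁ k₁₁′)
    aligned {k₀₀′ = k₀₀′} {k₀₁′ = k₀₁′} {k₁₀′ = k₁₀′} {k₁₁′ = k₁₁′} p₀₀ p₀₁ p₁₀ p₁₁ =
      trans (cong₂ _+_ (cong₂ _+_ p₀₀ p₀₁) (cong₂ _+_ p₁₀ p₁₁))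
            (interchange (t₀₀ k₀₀′) (t₀₁ k₀₁′) (t₁₀ k₁₀′) (t₁₁ k₁₁′))

    crossed : ∀ {k₀₀ k₀₀′ k₀₁ k₀₁′ k₁₀ k₁₀′ k₁₁ k₁₁′} →
      t₀₀ k₀₀ ≡ t₀₀ k₀₀′ → t₀₁ k₀₁ ≡ t₁₀ k₁₀′ → t₁₀ k₁₀ ≡ t₀₁ k₀₁′ → t₁₁ k₁₁ ≡ t₁₁ k₁₁′ →
      (t₀₀ k₀₀ + t₀₁ k₀₁) + (t₁₀ k₁₀ + t₁₁ k₁₁) ≡ (t₀₀ k₀₀′ + t₁₀ k₁₀′) + (t₀₁ k₀₁′ + t₁₁ k₁₁′)
    crossed p₀₀ p₀₁ p₁₀ p₁₁ = cong₂ _+_ (cong₂ _+_ p₀₀ p₀₁) (cong₂ _+_ p₁₀ p₁₁)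

  -- Expanding first at one element and then at another, or the other way round,
  -- gives the same four families tᵤᵥ (u, v the membership of the two elements) with
  -- shifts computed from the emptiness flags a, b, c, d of these families.  The
  -- shifts agree whenever the family is non-empty, except when both mixed families
  -- are non-empty and a diagonal one is empty: then the two elements are parallel
  -- or in series, and t₀₁ = t₁₀ absorbs the difference.
  expansions-commute : (a b c d p q r s : Bool) (h : ℕ → ℕ → Bool) →
    p ≡ c ∧ d → q ≡ a ∧ b → r ≡ b ∧ d → s ≡ a ∧ c →
    (a ≡ true → ∀ k → t₀₀ k ≡ 0) → (b ≡ true → ∀ k → t₀₁ k ≡ 0) →
    (c ≡ true → ∀ k → t₁₀ k ≡ 0) → (d ≡ true → ∀ k → t₁₁ k ≡ 0) →
    (a ≡ false → d ≡ false → b ≡ false × c ≡ false) →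
    (b ≡ false → c ≡ false → a ≡ true ⊎ d ≡ true → ∀ k → t₀₁ k ≡ t₁₀ k) →
    (t₀₀ (shiftᵉ b (shiftᵉ p h)) + t₀₁ (shiftⁱ a (shiftᵉ p h)))
      + (t₁₀ (shiftᵉ d (shiftⁱ q h)) + t₁₁ (shiftⁱ c (shiftⁱ q h)))
    ≡ (t₀₀ (shiftᵉ c (shiftᵉ r h)) + t₁₀ (shiftⁱ a (shiftᵉ r h)))
      + (t₀₁ (shiftᵉ d (shiftⁱ s h)) + t₁₁ (shiftⁱ b (shiftⁱ s h)))
  expansions-commute true true true true _ _ _ _ _ refl refl refl refl z₀₀ z₀₁ z₁₀ z₁₁ _ _ =
    aligned (vanish (z₀₀ refl)) (vanish (z₀₁ refl)) (vanish (z₁₀ refl)) (vanish (z₁₁ refl))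
  expansions-commute true true true false _ _ _ _ _ refl refl refl refl z₀₀ z₀₁ z₁₀ z₁₁ _ _ =
    aligned (vanish (z₀₀ refl)) (vanish (z₀₁ refl)) (vanish (z₁₀ refl)) refl
  expansions-commute true true false true _ _ _ _ _ refl refl refl refl z₀₀ z₀₁ z₁₀ z₁₁ _ _ =
    aligned (vanish (z₀₀ refl)) (vanish (z₀₁ refl)) refl (vanish (z₁₁ refl))
  expansions-commute true true false false _ _ _ _ _ refl refl refl refl z₀₀ z₀₁ z₁₀ z₁₁ _ _ =
    aligned (vanish (z₀₀ refl)) (vanish (z₀₁ refl)) refl refl
  expansions-commute true false true true _ _ _ _ _ refl refl refl refl z₀₀ z₀₁ z₁₀ z₁₁ _ _ =
    aligned (vanish (z₀₀ refl)) refl (vanish (z₁₀ refl)) (vanish (z₁₁ refl))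
  expansions-commute true false true false _ _ _ _ _ refl refl refl refl z₀₀ z₀₁ z₁₀ z₁₁ _ _ =
    aligned (vanish (z₀₀ refl)) refl (vanish (z₁₀ refl)) refl
  expansions-commute true false false true _ _ _ _ _ refl refl refl refl z₀₀ z₀₁ z₁₀ z₁₁ _ swap =
    crossed (vanish (z₀₀ refl)) (swap refl refl (inj₁ refl) _) (sym (swap refl refl (inj₁ refl) _)) (vanish (z₁₁ refl))
  expansions-commute true false false false _ _ _ _ _ refl refl refl refl z₀₀ z₀₁ z₁₀ z₁₁ _ swap =
    crossed (vanish (z₀₀ refl)) (swap refl refl (inj₁ refl) _) (sym (swap refl refl (inj₁ refl) _)) refl
  expansions-commute false true true true _ _ _ _ _ refl refl refl refl z₀₀ z₀₁ z₁₀ z₁₁ _ _ =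
    aligned refl (vanish (z₀₁ refl)) (vanish (z₁₀ refl)) (vanish (z₁₁ refl))
  expansions-commute false true true false _ _ _ _ _ refl refl refl refl _ _ _ _ mixed _ =
    ⊥-elim (true≢false (proj₁ (mixed refl refl)))
  expansions-commute false true false true _ _ _ _ _ refl refl refl refl z₀₀ z₀₁ z₁₀ z₁₁ _ _ =
    aligned refl (vanish (z₀₁ refl)) refl (vanish (z₁₁ refl))
  expansions-commute false true false false _ _ _ _ _ refl refl refl refl _ _ _ _ mixed _ =
    ⊥-elim (true≢false (proj₁ (mixed refl refl)))
  expansions-commute false false true true _ _ _ _ _ refl refl refl refl z₀₀ z₀₁ z₁₀ z₁₁ _ _ =
    aligned refl refl (vanish (z₁₀ refl)) (vanish (z₁₁ refl))
  expansions-commute false false true false _ _ _ _ _ refl refl refl refl _ _ _ _ mixed _ =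
    ⊥-elim (true≢false (proj₂ (mixed refl refl)))
  expansions-commute false false false true _ _ _ _ _ refl refl refl refl z₀₀ z₀₁ z₁₀ z₁₁ _ swap =
    crossed refl (swap refl refl (inj₂ refl) _) (sym (swap refl refl (inj₂ refl) _)) (vanish (z₁₁ refl))
  expansions-commute false false false false _ _ _ _ _ refl refl refl refl _ _ _ _ _ _ =
    aligned refl refl refl refl

module TwoElements (m : ℕ) (f : Subset (suc (suc m)) → Bool) (exch : Exchange (suc (suc m)) f)
                   (e : Fin (suc m)) where

  restrict : Bool → Bool → Subset m → Bool
  restrict a b = minor e b (minor zero a f)

  restrict-nonempty : ∀ V {a b} → T (f V) → lookup V zero ≡ a → lookup V (suc e) ≡ b →
    none (restrict a b) ≡ false
  restrict-nonempty (v ∷ V) b refl refl = witness⇒none-false (restrict v (lookup V e)) (removeAt V e)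
    (subst (λ U → T (f (v ∷ U))) (sym (VecP.insertAt-removeAt V e)) b)

  off-diagonal-nonempty : none (restrict false false) ≡ false → none (restrict true true) ≡ false →
    none (restrict false true) ≡ false × none (restrict true false) ≡ false
  off-diagonal-nonempty none₀₀ none₁₁
    with none-false⇒witness (restrict false false) none₀₀ | none-false⇒witness (restrict true true) none₁₁
  ... | S₀ , b₀ | S₁ , b₁ = out-of-zero , out-of-e
    where
    B₀₀ B₁₁ : Subset (suc (suc m))
    B₀₀ = false ∷ insertAt S₀ e false
    B₁₁ = true ∷ insertAt S₁ e true
    B₁₁e : lookup B₁₁ (suc e) ≡ true
    B₁₁e = VecP.insertAt-lookup S₁ e true
    out-of-zero : none (restrict false true) ≡ false
    out-of-zero with exch B₁₁ B₀₀ b₁ b₀ zero refl refl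
    ... | y , _ , B₁₁y , b′ = restrict-nonempty ((B₁₁ -ₛ zero) +ₛ y) b′
      (lookup-exchange-out B₁₁ {zero} {y} (≢-by-lookup B₁₁ refl B₁₁y))
      (trans (lookup-exchange-other B₁₁ {zero} {y} {suc e} (λ ()) (≢-by-lookup B₁₁ B₁₁e B₁₁y)) B₁₁e)
    out-of-e : none (restrict true false) ≡ false
    out-of-e with exch B₁₁ B₀₀ b₁ b₀ (suc e) B₁₁e (VecP.insertAt-lookup S₀ e false)
    ... | y , _ , B₁₁y , b′ = restrict-nonempty ((B₁₁ -ₛ suc e) +ₛ y) b′
      (lookup-exchange-other B₁₁ {suc e} {y} {zero} (λ ()) (≢-by-lookup B₁₁ refl B₁₁y))
      (lookup-exchange-out B₁₁ {suc e} {y} (≢-by-lookup B₁₁ B₁₁e B₁₁y))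

  private
    impossible : ∀ {a b} {A : Set} → none (restrict a b) ≡ true → none (restrict a b) ≡ false → A
    impossible empty nonempty = ⊥-elim (true≢false (trans (sym empty) nonempty))

    suc≢suc : ∀ {y} → y ≢ e → suc e ≢ suc y
    suc≢suc y≢e p = y≢e (sym (suc-injective p))

  -- If a diagonal family is empty, the two elements are parallel or in series,
  -- so swapping them maps the two mixed families onto each other.
  mixed₀₁⇒mixed₁₀ : ∀ {S₁₀} → T (restrict true false S₁₀) →
    none (restrict false false) ≡ true ⊎ none (restrict true true) ≡ true →
    ∀ S → T (restrict false true S) → T (restrict true false S)
  mixed₀₁⇒mixed₁₀ {S₁₀} c (inj₁ empty₀₀) S b
    with exch (false ∷ insertAt S e true) (true ∷ insertAt S₁₀ e false) b c (suc e)
              (VecP.insertAt-lookup S e true) (VecP.insertAt-lookup S₁₀ e false)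
  ... | zero  , _ , _   , b′ = subst (λ U → T (f (true ∷ U))) (insertAt-update-self S e true false) b′
  ... | suc y , _ , B₀₁y , b′ = impossible empty₀₀ (restrict-nonempty _ b′ refl
        (lookup-exchange-out (false ∷ insertAt S e true) {suc e} {suc y}
           (≢-by-lookup (false ∷ insertAt S e true) (VecP.insertAt-lookup S e true) B₀₁y)))
  mixed₀₁⇒mixed₁₀ c (inj₂ empty₁₁) S b with exchange-insert exch {x = zero} b c refl refl
  ... | zero  , () , _
  ... | suc y , _ , b′ with y ≟ᶠ e
  ...   | yes refl = subst (λ U → T (f (true ∷ U))) (insertAt-update-self S e true false) b′
  ...   | no y≢e   = impossible empty₁₁ (restrict-nonempty _ b′ refl
        (trans (lookup-exchange-other (false ∷ insertAt S e true) {suc y} {zero} {suc e} (suc≢suc y≢e) (λ ()))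
               (VecP.insertAt-lookup S e true)))

  mixed₁₀⇒mixed₀₁ : ∀ {S₀₁} → T (restrict false true S₀₁) →
    none (restrict false false) ≡ true ⊎ none (restrict true true) ≡ true →
    ∀ S → T (restrict true false S) → T (restrict false true S)
  mixed₁₀⇒mixed₀₁ c (inj₁ empty₀₀) S b with exch (true ∷ insertAt S e false) _ b c zero refl refl
  ... | zero  , _ , () , _
  ... | suc y , _ , _  , b′ with y ≟ᶠ e
  ...   | yes refl = subst (λ U → T (f (false ∷ U))) (insertAt-update-self S e false true) b′
  ...   | no y≢e   = impossible empty₀₀ (restrict-nonempty _ b′ refl
        (trans (lookup-exchange-other (true ∷ insertAt S e false) {zero} {suc y} {suc e} (λ ()) (suc≢suc y≢e))
               (VecP.insertAt-lookup S e false)))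
  mixed₁₀⇒mixed₀₁ {S₀₁} c (inj₂ empty₁₁) S b
    with exchange-insert exch {x = suc e} b c (VecP.insertAt-lookup S e false) (VecP.insertAt-lookup S₀₁ e true)
  ... | zero  , _ , b′ = subst (λ U → T (f (false ∷ U))) (insertAt-update-self S e false true) b′
  ... | suc y , B₁₀y , b′ with y ≟ᶠ e
  ...   | yes refl = ⊥-elim (true≢false (trans (sym B₁₀y) (VecP.insertAt-lookup S y false)))
  ...   | no _     = impossible empty₁₁ (restrict-nonempty _ b′ refl
        (lookup-exchange-in (true ∷ insertAt S e false) {suc y} {suc e}))

  off-diagonal-equal : none (restrict false true) ≡ false → none (restrict true false) ≡ false →
    none (restrict false false) ≡ true ⊎ none (restrict true true) ≡ true →
    ∀ S → restrict false true S ≡ restrict true false S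
  off-diagonal-equal none₀₁ none₁₀ diagonal S =
    T-ext (mixed₀₁⇒mixed₁₀ (proj₂ (none-false⇒witness (restrict true false) none₁₀)) diagonal S)
          (mixed₁₀⇒mixed₀₁ (proj₂ (none-false⇒witness (restrict false true) none₀₁)) diagonal S)

tutteCount-expand : ∀ n (f : Subset (suc n) → Bool) → Exchange (suc n) f → ∀ e h →
  tutteCount (suc n) f h
    ≡ tutteCount n (minor e false f) (shiftᵉ (isLoop e f) h)
    + tutteCount n (minor e true f) (shiftⁱ (isColoop e f) h)
tutteCount-expand n       f exch zero    h = refl
tutteCount-expand (suc m) f exch (suc e) h =
  trans (cong₂ _+_ (tutteCount-expand m (minor zero false f) (exchange-minor (suc m) zero false exch) e
                                      (shiftᵉ (isLoop zero f) h))
                   (tutteCount-expand m (minor zero true f) (exchange-minor (suc m) zero true exch) e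
                                      (shiftⁱ (isColoop zero f) h)))
        (expansions-commute (t false false) (t false true) (t true false) (t true true)
           (none (restrict false false)) (none (restrict false true))
           (none (restrict true false)) (none (restrict true true))
           (isLoop zero f) (isColoop zero f) (isLoop (suc e) f) (isColoop (suc e) f) h
           (none-insertAt m e (minor zero true f)) (none-insertAt m e (minor zero false f))
           (none-insertAt m zero (minor (suc e) true f)) (none-insertAt m zero (minor (suc e) false f))
           (vanishes false false) (vanishes false true) (vanishes true false) (vanishes true true)
           off-diagonal-nonempty
           λ none₀₁ none₁₀ diagonal k →
             tutteCount-cong m (off-diagonal-equal none₀₁ none₁₀ diagonal) λ _ _ → refl)
  where
  open TwoElements m f exch e
  t : Bool → Bool → (ℕ → ℕ → Bool) → ℕ
  t a b = tutteCount m (restrict a b)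
  vanishes : ∀ a b → none (restrict a b) ≡ true → ∀ k → t a b k ≡ 0
  vanishes a b empty k = tutteCount-none m (restrict a b) k (none-true⇒false (restrict a b) empty)

maximum-at : ∀ n (r : Fin (suc n) → ℕ) → ∃ λ e → ∀ x → r x ≤ r e
maximum-at zero    r = zero , λ { zero → ≤-refl }
maximum-at (suc n) r with maximum-at n (r ∘ suc)
... | e , r≤ with ≤-total (r zero) (r (suc e))
... | inj₁ r₀≤ = suc e , λ { zero → r₀≤ ; (suc x) → r≤ x }
... | inj₂ r₀≥ = zero , λ { zero → ≤-refl ; (suc x) → ≤-trans (r≤ x) r₀≥ }

strict-maximum-at : ∀ n (r : Fin (suc n) → ℕ) → Injective _≡_ _≡_ r → ∃ λ e → ∀ j → r (punchIn e j) < r e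
strict-maximum-at n r r-inj with maximum-at n r
... | e , r≤ = e , λ j → ≤∧≢⇒< (r≤ (punchIn e j)) (punchInᵢ≢i e j ∘ r-inj)

activityCount≡tutteCount : ∀ n (f : Subset n → Bool) (r : Fin n → ℕ) → Exchange n f →
  Injective _≡_ _≡_ r → ∀ h → activityCount n f r h ≡ tutteCount n f h
activityCount≡tutteCount zero    f r exch r-inj h = if-bit (f [] ∧ h 0 0)
  where
  if-bit : ∀ b → (if b then 1 else 0) ≡ bit b
  if-bit true  = refl
  if-bit false = refl
activityCount≡tutteCount (suc n) f r exch r-inj h with strict-maximum-at n r r-inj
... | e , e-top = begin
  activityCount (suc n) f r h
    ≡⟨ activityCount-expand n f r e exch e-top h ⟩
  activityCount n (minor e false f) r′ hᵉ + activityCount n (minor e true f) r′ hⁱ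
    ≡⟨ cong₂ _+_ (activityCount≡tutteCount n _ r′ (exchange-minor n e false exch) r′-inj hᵉ)
                 (activityCount≡tutteCount n _ r′ (exchange-minor n e true exch) r′-inj hⁱ) ⟩
  tutteCount n (minor e false f) hᵉ + tutteCount n (minor e true f) hⁱ
    ≡⟨ tutteCount-expand n f exch e h ⟨
  tutteCount (suc n) f h ∎
  where
  open ≡-Reasoning
  r′ : Fin n → ℕ
  r′ = r ∘ punchIn e
  hᵉ hⁱ : ℕ → ℕ → Bool
  hᵉ = shiftᵉ (isLoop e f) h
  hⁱ = shiftⁱ (isColoop e f) h
  r′-inj : Injective _≡_ _≡_ r′
  r′-inj = punchIn-injective e _ _ ∘ r-inj

activityCount-ranking-free : ∀ n (f : Subset n → Bool) (r r′ : Fin n → ℕ) → Exchange n f →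
  Injective _≡_ _≡_ r → Injective _≡_ _≡_ r′ → ∀ h → activityCount n f r h ≡ activityCount n f r′ h
activityCount-ranking-free n f r r′ exch r-inj r′-inj h =
  trans (activityCount≡tutteCount n f r exch r-inj h) (sym (activityCount≡tutteCount n f r′ exch r′-inj h))

-- The index i_ω(B) of a basis is its internal activity

∈-allSubsets : ∀ {n} (S : Subset n) → S ∈ᴸ allSubsets n
∈-allSubsets []          = here refl
∈-allSubsets (true ∷ S)  = ∈-++⁺ˡ (∈-map⁺ (true ∷_) (∈-allSubsets S))
∈-allSubsets (false ∷ S) = ∈-++⁺ʳ (mapᴸ (true ∷_) (allSubsets _)) (∈-map⁺ (false ∷_) (∈-allSubsets S))

any-allSubsets⁺ : ∀ {n} (p : Subset n → Bool) S → T (p S) → T (any p (allSubsets n))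
any-allSubsets⁺ p S t = any⁺ p (lose (∈-allSubsets S) t)

any-allFin⁺ : ∀ {n} (p : Fin n → Bool) x → T (p x) → T (any p (allFin n))
any-allFin⁺ p x t = any⁺ p (lose (∈-allFin x) t)

any-allFin⁻ : ∀ {n} (p : Fin n → Bool) → T (any p (allFin n)) → ∃ λ x → T (p x)
any-allFin⁻ {n} p t = satisfied (any⁻ p (allFin n) t)

all-allFin⁺ : ∀ n (p : Fin n → Bool) → T (allᶠ n p) → T (all p (allFin n))
all-allFin⁺ n p t = all⁻ p {allFin n} (All.tabulate λ {x} _ → allᶠ-sound n t x)

all-allFin⁻ : ∀ n (p : Fin n → Bool) → T (all p (allFin n)) → T (allᶠ n p)
all-allFin⁻ n p t = allᶠ-complete n λ x → All.lookup (all⁺ p (allFin n) t) (∈-allFin x)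

==ₛ-sound : ∀ {n} (S S′ : Subset n) → T (S ==ₛ S′) → S ≡ S′
==ₛ-sound S S′ t with VecP.≡-dec _≟ᵇ_ S S′
... | yes S≡S′ = S≡S′

==ₛ-complete : ∀ {n} {S S′ : Subset n} → S ≡ S′ → T (S ==ₛ S′)
==ₛ-complete {S = S} {S′} S≡S′ = from T-≡ (dec-true (VecP.≡-dec _≟ᵇ_ S S′) S≡S′)

==ₛ-refl : ∀ {n} (S : Subset n) → T (S ==ₛ S)
==ₛ-refl S = ==ₛ-complete {S = S} refl

countˢ-==ₛ : ∀ n (S : Subset n) → countˢ n (_==ₛ S) ≡ 1
countˢ-==ₛ zero    []          = refl
countˢ-==ₛ (suc n) (true ∷ S)  =
  trans (countˢ-suc n (_==ₛ (true ∷ S))) (cong₂ _+_ (countˢ-==ₛ n S) (count-false (allSubsets n)))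
countˢ-==ₛ (suc n) (false ∷ S) =
  trans (countˢ-suc n (_==ₛ (false ∷ S))) (cong₂ _+_ (count-false (allSubsets n)) (countˢ-==ₛ n S))

countˢ-∧-==ₛ : ∀ n (S : Subset n) c → countˢ n (λ D → c ∧ (D ==ₛ S)) ≡ bit c
countˢ-∧-==ₛ n S true  = countˢ-==ₛ n S
countˢ-∧-==ₛ n S false = count-false (allSubsets n)

countˢ-image : ∀ n k (Q : Fin k → Bool) (g : Fin k → Subset n) →
  (∀ x y → T (Q x) → T (Q y) → g x ≡ g y → x ≡ y) →
  countˢ n (λ D → anyᶠ k (λ x → Q x ∧ (D ==ₛ g x))) ≡ countᶠ k Q
countˢ-image n zero    Q g g-inj = count-false (allSubsets n)
countˢ-image n (suc k) Q g g-inj =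
  trans (count-∨ (allSubsets n) (λ D → Q zero ∧ (D ==ₛ g zero)) _ disjoint)
        (cong₂ _+_ (countˢ-∧-==ₛ n (g zero) (Q zero))
                   (countˢ-image n k (Q ∘ suc) (g ∘ suc) λ x y Qx Qy gx≡gy → suc-injective (g-inj _ _ Qx Qy gx≡gy)))
  where
  disjoint : ∀ D → T (Q zero ∧ (D ==ₛ g zero)) → T (anyᶠ k (λ x → Q (suc x) ∧ (D ==ₛ g (suc x)))) → ⊥
  disjoint D t t′ with anyᶠ-sound k t′
  ... | x , tx with to (T-∧ {Q zero}) t | to (T-∧ {Q (suc x)}) tx
  ... | Q₀ , D≡g₀ | Qx , D≡gx
    with g-inj zero (suc x) Q₀ Qx (trans (sym (==ₛ-sound D (g zero) D≡g₀)) (==ₛ-sound D (g (suc x)) D≡gx))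
  ... | ()

+ₛ-−ₛ : ∀ {n} (D : Subset n) x → lookup D x ≡ false → (D +ₛ x) -ₛ x ≡ D
+ₛ-−ₛ D x Dx = trans (VecP.[]≔-idempotent D x) (trans (cong (D [ x ]≔_) (sym Dx)) (VecP.[]≔-lookup D x))

−ₛ-+ₛ : ∀ {n} (B : Subset n) x → lookup B x ≡ true → (B -ₛ x) +ₛ x ≡ B
−ₛ-+ₛ B x Bx = trans (VecP.[]≔-idempotent B x) (trans (cong (B [ x ]≔_) (sym Bx)) (VecP.[]≔-lookup B x))

module _ {n} (𝓑 : PreMatroid n) (ω : Permutation′ n) {B : Subset n} (b : T (isBasis 𝓑 B)) (D : Subset n) where

  private
    f : Subset n → Bool
    f = isBasis 𝓑

    removes-active : Bool
    removes-active = anyᶠ n (λ x → (lookup B x ∧ isActive f (rank ω) B x) ∧ (D ==ₛ (B -ₛ x)))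

  φ≡ᵇ⇒active : T (φ≡ᵇ 𝓑 ω D B) → T removes-active
  φ≡ᵇ⇒active t with any-allFin⁻ _ (proj₂ (to (T-∧ {isAlmostBasisᵇ 𝓑 D}) t))
  ... | x , found with to (T-∧ {inUᵇ 𝓑 D x}) found
  ... | x∈U , least-D+x==B with to T-∧ least-D+x==B
  ... | least , D+x==B = anyᶠ-complete n x (from T-∧ (from T-∧ (Bx , active) , ==ₛ-complete D≡B-x))
    where
    D+x≡B : D +ₛ x ≡ B
    D+x≡B = ==ₛ-sound (D +ₛ x) B D+x==B
    Dx : lookup D x ≡ false
    Dx = to T-not-≡ (proj₁ (to (T-∧ {not (lookup D x)}) x∈U))
    D≡B-x : D ≡ B -ₛ x
    D≡B-x = trans (sym (+ₛ-−ₛ D x Dx)) (cong (_-ₛ x) D+x≡B)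
    Bx : T (lookup B x)
    Bx = subst (λ V → T (lookup V x)) D+x≡B (subst T (sym (VecP.lookup∘update x D true)) tt)
    active : T (isActive f (rank ω) B x)
    active = subst (λ V → T (allᶠ n (λ y → completes f V y ⇒ᵇ (rank ω x ≤ᵇ rank ω y)))) D≡B-x
                   (all-allFin⁻ n _ least)

  active⇒φ≡ᵇ : T removes-active → T (φ≡ᵇ 𝓑 ω D B)
  active⇒φ≡ᵇ t with anyᶠ-sound n t
  ... | x , found with to T-∧ found
  ... | Bx-active , D==B-x with to (T-∧ {lookup B x}) Bx-active | ==ₛ-sound D (B -ₛ x) D==B-x
  ... | Bx , active | refl = from T-∧
    ( any-allSubsets⁺ _ B (any-allFin⁺ _ x (from T-∧ (b , from T-∧ (Bx , ==ₛ-refl (B -ₛ x)))))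
    , any-allFin⁺ _ x (from T-∧ (x∈U , from T-∧ (all-allFin⁺ n _ active , ==ₛ-complete B-x+x≡B))))
    where
    B-x+x≡B : (B -ₛ x) +ₛ x ≡ B
    B-x+x≡B = −ₛ-+ₛ B x (to T-≡ Bx)
    x∈U : T (inUᵇ 𝓑 (B -ₛ x) x)
    x∈U = from T-∧ (from T-not-≡ (VecP.lookup∘update x B false) , subst (T ∘ f) (sym B-x+x≡B) b)

  φ≡ᵇ⇔active : φ≡ᵇ 𝓑 ω D B ≡ anyᶠ n (λ x → (lookup B x ∧ isActive (isBasis 𝓑) (rank ω) B x) ∧ (D ==ₛ (B -ₛ x)))
  φ≡ᵇ⇔active = T-ext φ≡ᵇ⇒active active⇒φ≡ᵇ

index≡internalActivity : ∀ {n} (𝓑 : PreMatroid n) (ω : Permutation′ n) B → T (isBasis 𝓑 B) →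
  index 𝓑 ω B ≡ internalActivity n (isBasis 𝓑) (rank ω) B
index≡internalActivity {n} 𝓑 ω B b =
  trans (count-cong (allSubsets n) (φ≡ᵇ⇔active 𝓑 ω b)) (countˢ-image n n active (B -ₛ_) removal-injective)
  where
  active : Fin n → Bool
  active x = lookup B x ∧ isActive (isBasis 𝓑) (rank ω) B x
  removal-injective : ∀ x y → T (active x) → T (active y) → B -ₛ x ≡ B -ₛ y → x ≡ y
  removal-injective x y Qx _ B-x≡B-y with x ≟ᶠ y
  ... | yes x≡y = x≡y
  ... | no  x≢y = ⊥-elim (true≢false (begin
    true              ≡⟨ to T-≡ (proj₁ (to (T-∧ {lookup B x}) Qx)) ⟨
    lookup B x        ≡⟨ VecP.lookup∘update′ x≢y B false ⟨
    lookup (B -ₛ y) x ≡⟨ cong (λ V → lookup V x) B-x≡B-y ⟨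
    lookup (B -ₛ x) x ≡⟨ VecP.lookup∘update x B false ⟩
    false             ∎))
    where open ≡-Reasoning

rank-injective : ∀ {n} (ω : Permutation′ n) → Injective _≡_ _≡_ (rank ω)
rank-injective ω {x} {y} rx≡ry =
  trans (sym (inverseˡ ω)) (trans (cong (ω ⟨$⟩ˡ_) (toℕ-injective rx≡ry)) (inverseˡ ω))

transpose-matchˡ : ∀ {n} (i j : Fin n) → PC.transpose i j i ≡ j
transpose-matchˡ i j rewrite dec-true (i ≟ᶠ i) refl = refl

transpose-matchʳ : ∀ {n} {i j : Fin n} → i ≢ j → PC.transpose i j j ≡ i
transpose-matchʳ {i = i} {j} i≢j rewrite dec-false (j ≟ᶠ i) (i≢j ∘ sym) | dec-true (j ≟ᶠ j) refl = refl

transpose-other : ∀ {n} {i j k : Fin n} → k ≢ i → k ≢ j → PC.transpose i j k ≡ k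
transpose-other {i = i} {j} {k} k≢i k≢j rewrite dec-false (k ≟ᶠ i) k≢i | dec-false (k ≟ᶠ j) k≢j = refl

-- Case analysis on k against i and j, kept out of the goal (which mentions k ≟ i).
compare₃ : ∀ {n} (k i j : Fin n) → k ≡ i ⊎ (k ≢ i × k ≡ j) ⊎ (k ≢ i × k ≢ j)
compare₃ k i j with k ≟ᶠ i | k ≟ᶠ j
... | yes k≡i | _       = inj₁ k≡i
... | no k≢i  | yes k≡j = inj₂ (inj₁ (k≢i , k≡j))
... | no k≢i  | no k≢j  = inj₂ (inj₂ (k≢i , k≢j))

act-lookup : ∀ {n} (i j : Fin n) (S : Subset n) k → lookup (act (transpose i j) S) k ≡ lookup S (PC.transpose j i k)
act-lookup i j S = VecP.lookup∘tabulate (λ k → lookup S (PC.transpose j i k))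

act-map : ∀ {n} (σ : Permutation′ n) (g : Bool → Bool) (S : Subset n) → act σ (mapⱽ g S) ≡ mapⱽ g (act σ S)
act-map σ g S = lookup-ext λ k → begin
  lookup (act σ (mapⱽ g S)) k   ≡⟨ VecP.lookup∘tabulate (lookup (mapⱽ g S) ∘ (σ ⟨$⟩ˡ_)) k ⟩
  lookup (mapⱽ g S) (σ ⟨$⟩ˡ k)  ≡⟨ VecP.lookup-map (σ ⟨$⟩ˡ k) g S ⟩
  g (lookup S (σ ⟨$⟩ˡ k))       ≡⟨ cong g (VecP.lookup∘tabulate (lookup S ∘ (σ ⟨$⟩ˡ_)) k) ⟨
  g (lookup (act σ S) k)        ≡⟨ VecP.lookup-map k g (act σ S) ⟨
  lookup (mapⱽ g (act σ S)) k   ∎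
  where open ≡-Reasoning

act-exchange : ∀ {n} (B : Subset n) {x y} → lookup B x ≡ true → lookup B y ≡ false →
  act (transpose x y) B ≡ (B -ₛ x) +ₛ y
act-exchange B {x} {y} Bx By = lookup-ext λ k → trans (act-lookup x y B k) (pointwise k)
  where
  x≢y : x ≢ y
  x≢y = ≢-by-lookup B Bx By
  pointwise : ∀ k → lookup B (PC.transpose y x k) ≡ lookup ((B -ₛ x) +ₛ y) k
  pointwise k with compare₃ k y x
  ... | inj₁ refl               =
    trans (cong (lookup B) (transpose-matchˡ k x)) (trans Bx (sym (lookup-exchange-in B)))
  ... | inj₂ (inj₁ (_ , refl))  =
    trans (cong (lookup B) (transpose-matchʳ (x≢y ∘ sym))) (trans By (sym (lookup-exchange-out B x≢y)))
  ... | inj₂ (inj₂ (k≢y , k≢x)) =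
    trans (cong (lookup B) (transpose-other k≢y k≢x)) (sym (lookup-exchange-other B k≢x k≢y))

act-fixes : ∀ {n} (S : Subset n) {i j} → lookup S i ≡ lookup S j → act (transpose i j) S ≡ S
act-fixes S {i} {j} Si≡Sj = lookup-ext λ k → trans (act-lookup i j S k) (pointwise k)
  where
  pointwise : ∀ k → lookup S (PC.transpose j i k) ≡ lookup S k
  pointwise k with compare₃ k j i
  ... | inj₁ refl                = trans (cong (lookup S) (transpose-matchˡ k i)) Si≡Sj
  ... | inj₂ (inj₁ (k≢j , refl)) = trans (cong (lookup S) (transpose-matchʳ (k≢j ∘ sym))) (sym Si≡Sj)
  ... | inj₂ (inj₂ (k≢j , k≢i))  = cong (lookup S) (transpose-other k≢j k≢i)

-- Linkings out of a matroid

module _ {n} {𝓑 𝓑* : PreMatroid n} (L : Linking 𝓑 𝓑*) where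

  star-cong : ∀ {B B′} (b : T (isBasis 𝓑 B)) (b′ : T (isBasis 𝓑 B′)) → B ≡ B′ → star L (B , b) ≡ star L (B′ , b′)
  star-cong b b′ refl = cong (λ c → star L (_ , c)) (T-irrelevant b b′)

  starS≡star : ∀ B (b : T (isBasis 𝓑 B)) → starS L B ≡ star L (B , b)
  starS≡star B b with T? (isBasis 𝓑 B)
  ... | yes b′ = star-cong b′ b refl
  ... | no ¬b  = ⊥-elim (¬b b)

  star-basis : ∀ B (b : T (isBasis 𝓑 B)) → T (isBasis 𝓑* (star L (B , b)))
  star-basis B b = proj₂ (Bijection.to (bij L) (B , b))

  star-exchange : ∀ {B x y} (b : T (isBasis 𝓑 B)) → lookup B x ≡ true → lookup B y ≡ false →
    (b′ : T (isBasis 𝓑 ((B -ₛ x) +ₛ y))) → star L (((B -ₛ x) +ₛ y) , b′) ≡ act (transpose x y) (star L (B , b))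
  star-exchange {B} {x} {y} b Bx By b′ =
    trans (star-cong b′ τb (sym τB≡)) (sym (proj₂ (L1 L B b x y (≢-by-lookup B Bx By) τb)))
    where
    τB≡ : act (transpose x y) B ≡ (B -ₛ x) +ₛ y
    τB≡ = act-exchange B Bx By
    τb : T (isBasis 𝓑 (act (transpose x y) B))
    τb = subst (T ∘ isBasis 𝓑) (sym τB≡) b′

  private
    B₀ : Subset n
    B₀ = proj₁ (nonempty 𝓑)
    b₀ : T (isBasis 𝓑 B₀)
    b₀ = proj₂ (nonempty 𝓑)
    C₀ : Subset n
    C₀ = star L (B₀ , b₀)

  star₀-respects : ∀ i j → lookup B₀ i ≡ lookup B₀ j → lookup C₀ i ≡ lookup C₀ j
  star₀-respects i j B₀i≡B₀j with i ≟ᶠ j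
  ... | yes refl = refl
  ... | no  i≢j  = begin
    lookup C₀ i                         ≡⟨ cong (lookup C₀) (transpose-matchˡ j i) ⟨
    lookup C₀ (PC.transpose j i j)      ≡⟨ act-lookup i j C₀ j ⟨
    lookup (act (transpose i j) C₀) j   ≡⟨ cong (λ V → lookup V j) τC₀≡C₀ ⟩
    lookup C₀ j                         ∎
    where
    open ≡-Reasoning
    τB₀≡B₀ : act (transpose i j) B₀ ≡ B₀
    τB₀≡B₀ = act-fixes B₀ B₀i≡B₀j
    τC₀≡C₀ : act (transpose i j) C₀ ≡ C₀
    τC₀≡C₀ = trans (proj₂ (L1 L B₀ b₀ i j i≢j (subst (T ∘ isBasis 𝓑) (sym τB₀≡B₀) b₀)))
                   (star-cong _ b₀ τB₀≡B₀)

  -- By star₀-respects any k with B₀ k = v gives the same value; the last clause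
  -- only concerns a value that B₀ does not take.
  rule : Bool → Bool
  rule v with any? (λ k → lookup B₀ k ≟ᵇ v)
  ... | yes (k , _) = lookup C₀ k
  ... | no _        = v

  star₀≡map : C₀ ≡ mapⱽ rule B₀
  star₀≡map = lookup-ext λ k → trans (at k) (sym (VecP.lookup-map k rule B₀))
    where
    at : ∀ k → lookup C₀ k ≡ rule (lookup B₀ k)
    at k with any? (λ k′ → lookup B₀ k′ ≟ᵇ lookup B₀ k)
    ... | yes (k′ , B₀k′≡B₀k) = star₀-respects k k′ (sym B₀k′≡B₀k)
    ... | no  ¬found          = ⊥-elim (¬found (k , refl))

  module _ (exch : Exchange n (isBasis 𝓑)) where

    star≡map : ∀ {B} (b : T (isBasis 𝓑 B)) → star L (B , b) ≡ mapⱽ rule B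
    star≡map b = exchange-connected exch (λ B → (b : T (isBasis 𝓑 B)) → star L (B , b) ≡ mapⱽ rule B)
      (λ {B} {x} {y} b Bx By b′ B*≡ b″ → begin
        star L ((B -ₛ x) +ₛ y , b″)             ≡⟨ star-exchange b Bx By b″ ⟩
        act (transpose x y) (star L (B , b))    ≡⟨ cong (act (transpose x y)) (B*≡ b) ⟩
        act (transpose x y) (mapⱽ rule B)       ≡⟨ act-map (transpose x y) rule B ⟩
        mapⱽ rule (act (transpose x y) B)       ≡⟨ cong (mapⱽ rule) (act-exchange B Bx By) ⟩
        mapⱽ rule ((B -ₛ x) +ₛ y)               ∎)
      b₀ b (λ b′ → trans (star-cong b′ b₀ refl) star₀≡map) b
      where open ≡-Reasoning

    linking-rule : ∃ λ g → ∀ B → T (isBasis 𝓑 B) → starS L B ≡ mapⱽ g B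
    linking-rule = rule , λ B b → trans (starS≡star B b) (star≡map b)

-- In a family with a single member S, every x ∈ S is active: only x completes S - x.
internalActivity-sole : ∀ n (f : Subset n → Bool) (r : Fin n → ℕ) (S : Subset n) →
  (∀ C → T (f C) → C ≡ S) → internalActivity n f r S ≡ countᶠ n (lookup S)
internalActivity-sole n f r S sole = countᶠ-cong n active
  where
  active : ∀ x → lookup S x ∧ isActive f r S x ≡ lookup S x
  active x with lookup S x in Sx
  ... | false = refl
  ... | true  = to T-≡ (allᶠ-complete n λ y → ⇒ᵇ-intro λ completes-y →
    subst (λ z → T (r x ≤ᵇ r z)) (only-x y (proj₂ (to (T-∧ {not (lookup (S -ₛ x) y)}) completes-y)))
          (≤⇒≤ᵇ (≤-refl {r x})))
    where
    only-x : ∀ y → T (f ((S -ₛ x) +ₛ y)) → x ≡ y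
    only-x y b with x ≟ᶠ y
    ... | yes x≡y = x≡y
    ... | no  x≢y = ⊥-elim (true≢false (begin
      true                      ≡⟨ Sx ⟨
      lookup S x                ≡⟨ cong (λ V → lookup V x) (sole _ b) ⟨
      lookup ((S -ₛ x) +ₛ y) x  ≡⟨ lookup-exchange-out S x≢y ⟩
      false                     ∎))
      where open ≡-Reasoning

module _ {n} {𝓑 𝓑* : PreMatroid n} (L : Linking 𝓑 𝓑*) where

  basis*-involution : (σ : Subset n → Subset n) → (∀ S → σ (σ S) ≡ S) →
    (∀ B → T (isBasis 𝓑 B) → starS L B ≡ σ B) → ∀ C → isBasis 𝓑* C ≡ isBasis 𝓑 (σ C)
  basis*-involution σ σσ star≡σ C = T-ext from* to*
    where
    from* : T (isBasis 𝓑* C) → T (isBasis 𝓑 (σ C))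
    from* c with Bijection.surjective (bij L) (C , c)
    ... | (B , b) , image = subst (T ∘ isBasis 𝓑) (trans (sym (σσ B)) (cong σ σB≡C)) b
      where
      σB≡C : σ B ≡ C
      σB≡C = trans (sym (star≡σ B b)) (trans (starS≡star L B b) (cong proj₁ (image refl)))
    to* : T (isBasis 𝓑 (σ C)) → T (isBasis 𝓑* C)
    to* b = subst (T ∘ isBasis 𝓑*) (trans (sym (starS≡star L (σ C) b)) (trans (star≡σ (σ C) b) (σσ C)))
                  (star-basis L (σ C) b)

  Whitney-involution : (σ : Subset n → Subset n) → (∀ S → σ (σ S) ≡ S) →
    (∀ B → T (isBasis 𝓑 B) → starS L B ≡ σ B) → ∀ ω p q →
    Whitney L ω (p , q) ≡ countˢ n (λ B → isBasis 𝓑 B ∧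
      ((internalActivity n (isBasis 𝓑) (rank ω) B ≡ᵇ p)
       ∧ (internalActivity n (isBasis 𝓑 ∘ σ) (rank ω) (σ B) ≡ᵇ q)))
  Whitney-involution σ σσ star≡σ ω p q = countˢ-cong n λ B → ∧-congˡ-T (isBasis 𝓑 B) λ b →
    cong₂ _∧_ (cong (_≡ᵇ p) (index≡internalActivity 𝓑 ω B b)) (cong (_≡ᵇ q) (index* B b))
    where
    open ≡-Reasoning
    basis* : ∀ C → isBasis 𝓑* C ≡ isBasis 𝓑 (σ C)
    basis* = basis*-involution σ σσ star≡σ
    index* : ∀ B → T (isBasis 𝓑 B) →
      index 𝓑* ω (starS L B) ≡ internalActivity n (isBasis 𝓑 ∘ σ) (rank ω) (σ B)
    index* B b = begin
      index 𝓑* ω (starS L B)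
        ≡⟨ cong (index 𝓑* ω) (star≡σ B b) ⟩
      index 𝓑* ω (σ B)
        ≡⟨ index≡internalActivity 𝓑* ω (σ B) (subst T (sym (trans (basis* (σ B)) (cong (isBasis 𝓑) (σσ B)))) b) ⟩
      internalActivity n (isBasis 𝓑*) (rank ω) (σ B)
        ≡⟨ internalActivity-cong n (rank ω) (σ B) basis* ⟩
      internalActivity n (isBasis 𝓑 ∘ σ) (rank ω) (σ B) ∎

  -- A constant linking is injective only if 𝓑, and hence 𝓑*, has a single basis.
  Whitney-constant : (C : Subset n) → (∀ B → T (isBasis 𝓑 B) → starS L B ≡ C) → ∀ ω p q →
    Whitney L ω (p , q) ≡ countˢ n (λ B → isBasis 𝓑 B ∧
      ((countᶠ n (lookup B) ≡ᵇ p) ∧ (countᶠ n (lookup C) ≡ᵇ q)))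
  Whitney-constant C star≡C ω p q = countˢ-cong n λ B → ∧-congˡ-T (isBasis 𝓑 B) λ b →
    cong₂ _∧_ (cong (_≡ᵇ p) (trans (index≡internalActivity 𝓑 ω B b)
                                   (internalActivity-sole n _ (rank ω) B (sole b))))
              (cong (_≡ᵇ q) (trans (cong (index 𝓑* ω) (star≡C B b))
                            (trans (index≡internalActivity 𝓑* ω C (c b))
                                   (internalActivity-sole n _ (rank ω) C sole*))))
    where
    c : ∀ {B} → T (isBasis 𝓑 B) → T (isBasis 𝓑* C)
    c {B} b = subst (T ∘ isBasis 𝓑*) (trans (sym (starS≡star L B b)) (star≡C B b)) (star-basis L B b)
    sole : ∀ {B} → T (isBasis 𝓑 B) → ∀ B′ → T (isBasis 𝓑 B′) → B′ ≡ B
    sole {B} b B′ b′ = cong proj₁ (Bijection.injective (bij L) (Σ-≡ (star-basis L B′ b′) (star-basis L B b)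
      (trans (sym (starS≡star L B′ b′)) (trans (star≡C B′ b′) (trans (sym (star≡C B b)) (starS≡star L B b))))))
      where
      Σ-≡ : ∀ {D D′} (d : T (isBasis 𝓑* D)) (d′ : T (isBasis 𝓑* D′)) → D ≡ D′ →
            _≡_ {A = Bases 𝓑*} (D , d) (D′ , d′)
      Σ-≡ d d′ refl = cong (_ ,_) (T-irrelevant d d′)
    sole* : ∀ C′ → T (isBasis 𝓑* C′) → C′ ≡ C
    sole* C′ c′ with Bijection.surjective (bij L) (C′ , c′)
    ... | (B , b) , image = trans (sym (cong proj₁ (image refl))) (trans (sym (starS≡star L B b)) (star≡C B b))

  Whitney-constant-order-free : ∀ {C} → (∀ B → T (isBasis 𝓑 B) → starS L B ≡ C) → ∀ ω ω′ p q →
    Whitney L ω (p , q) ≡ Whitney L ω′ (p , q)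
  Whitney-constant-order-free star≡C ω ω′ p q =
    trans (Whitney-constant _ star≡C ω p q) (sym (Whitney-constant _ star≡C ω′ p q))

map-constant : ∀ {n} {g : Bool → Bool} {v} → g true ≡ v → g false ≡ v → (B : Subset n) → mapⱽ g B ≡ replicate n v
map-constant {v = v} g₁ g₀ B = trans (VecP.map-cong (λ { true → g₁ ; false → g₀ }) B) (VecP.map-const B v)

activityCount-order-free : ∀ {n} (f : Subset n → Bool) → Exchange n f → ∀ (ω ω′ : Permutation′ n) h →
  activityCount n f (rank ω) h ≡ activityCount n f (rank ω′) h
activityCount-order-free {n} f exch ω ω′ =
  activityCount-ranking-free n f (rank ω) (rank ω′) exch (rank-injective ω) (rank-injective ω′)

Whitney-order-free : ∀ {n} {𝓑 𝓑* : PreMatroid n} (L : Linking 𝓑 𝓑*) → Exchange n (isBasis 𝓑) →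
  (g : Bool → Bool) → (∀ B → T (isBasis 𝓑 B) → starS L B ≡ mapⱽ g B) →
  ∀ ω ω′ p q → Whitney L ω (p , q) ≡ Whitney L ω′ (p , q)
Whitney-order-free {n} {𝓑} L exch g star≡g ω ω′ p q with g true in g₁ | g false in g₀
... | true  | false = begin
  Whitney L ω (p , q)                    ≡⟨ Whitney-involution L id (λ _ → refl) star≡B ω p q ⟩
  activityCount n (isBasis 𝓑) (rank ω) h  ≡⟨ activityCount-order-free (isBasis 𝓑) exch ω ω′ h ⟩
  activityCount n (isBasis 𝓑) (rank ω′) h ≡⟨ Whitney-involution L id (λ _ → refl) star≡B ω′ p q ⟨
  Whitney L ω′ (p , q)                   ∎
  where
  open ≡-Reasoning
  h : ℕ → ℕ → Bool
  h i _ = (i ≡ᵇ p) ∧ (i ≡ᵇ q)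
  star≡B : ∀ B → T (isBasis 𝓑 B) → starS L B ≡ B
  star≡B B b = trans (star≡g B b) (trans (VecP.map-cong (λ { true → g₁ ; false → g₀ }) B) (VecP.map-id B))
... | false | true  = begin
  Whitney L ω (p , q)                    ≡⟨ Whitney-involution L ∁ ∁-involutive star≡∁B ω p q ⟩
  activityCount n (isBasis 𝓑) (rank ω) h  ≡⟨ activityCount-order-free (isBasis 𝓑) exch ω ω′ h ⟩
  activityCount n (isBasis 𝓑) (rank ω′) h ≡⟨ Whitney-involution L ∁ ∁-involutive star≡∁B ω′ p q ⟨
  Whitney L ω′ (p , q)                   ∎
  where
  open ≡-Reasoning
  h : ℕ → ℕ → Bool
  h i j = (i ≡ᵇ p) ∧ (j ≡ᵇ q)
  star≡∁B : ∀ B → T (isBasis 𝓑 B) → starS L B ≡ ∁ B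
  star≡∁B B b = trans (star≡g B b) (VecP.map-cong (λ { true → g₁ ; false → g₀ }) B)
... | true  | true  = Whitney-constant-order-free L (λ B b → trans (star≡g B b) (map-constant g₁ g₀ B)) ω ω′ p q
... | false | false = Whitney-constant-order-free L (λ B b → trans (star≡g B b) (map-constant g₁ g₀ B)) ω ω′ p q

theorem7p1 : (n : ℕ) (𝓑 𝓑* : PreMatroid n) (L : Linking 𝓑 𝓑*) →
    IsMatroid 𝓑 → (ω ω′ : Permutation′ n) (pq : ℕ × ℕ) →
    Whitney L ω pq ≡ Whitney L ω′ pq
theorem7p1 n 𝓑 𝓑* L isM ω ω′ (p , q) with linking-rule L (isMatroid⇒exchange 𝓑 isM)
... | g , star≡g = Whitney-order-free L (isMatroid⇒exchange 𝓑 isM) g star≡g ω ω′ p q
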